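{- Let $k\ge4$, let $H$ be the $k$-th power of the Hamilton cycle on $[n]$ ($n$ sufficiently large), and let $H_s$ be the subgraph of $H$ induced by $[s]$. For all $F\subset H$ with $F^\circ\neq\emptyset$ we have $\gamma(F)\le\gamma(H_{|F|})$. Consequently $\gamma(s)=\gamma(H_s)$ for all $s>2$.
   Context: $H$ has vertex set $[n]$ and edges $\{v,v+i\}$ for $v\in[n]$, $i\in[k]$ (addition modulo $n$). For a graph $F$: $|F|$, $e(F)$, $c(F)$ denote the numbers of vertices, edges and components; $F^\circ$ is the union of the components of $F$ with more than $2$ vertices; if $e(F^\circ)>0$, $\gamma(F)=\frac{e(F^\circ)}{|F^\circ|-2c(F^\circ)}$. For $3\le s\le n$, $\gamma(s)=\max\{\gamma(F):F\subset H,\ |F|=s,\ e(F^\circ)>0\}$. -}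

module Defs where

open import Data.Nat using (ℕ; zero; suc; _+_; _∸_; _*_; _<ᵇ_; _≤ᵇ_; _≡ᵇ_)
open import Data.Nat.DivMod using (_%_)
open import Data.Bool using (Bool; true; false; _∧_; _∨_; not; if_then_else_)
open import Data.Bool.Properties using (∨-comm)
open import Data.Fin using (Fin; toℕ) renaming (zero to fzero; suc to fsuc)
open import Data.Integer using (+_)
open import Data.Rational.Unnormalised using (ℚᵘ; mkℚᵘ)
open import Data.Product using (_×_; Σ; _,_)
open import Relation.Binary.PropositionalEquality using (_≡_; refl; sym; subst)
open import Data.Unit using (tt)

count : {n : ℕ} → (Fin n → Bool) → ℕ
count {zero}  f = 0
count {suc n} f = (if f fzero then 1 else 0) + count (λ i → f (fsuc i))

sumF : {n : ℕ} → (Fin n → ℕ) → ℕ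
sumF {zero}  f = 0
sumF {suc n} f = f fzero + sumF (λ i → f (fsuc i))

anyF : {n : ℕ} → (Fin n → Bool) → Bool
anyF {zero}  f = false
anyF {suc n} f = f fzero ∨ anyF (λ i → f (fsuc i))

allF : {n : ℕ} → (Fin n → Bool) → Bool
allF {zero}  f = true
allF {suc n} f = f fzero ∧ allF (λ i → f (fsuc i))

-- The k-th power of the Hamilton cycle on n vertices.
-- Vertex set [n] is represented by Fin n (vertex j+1 of the paper is j).
-- dir u v : v ≡ u + i (mod n) for some i ∈ [k] = {1,…,k}.

dir : (n k : ℕ) → Fin n → Fin n → Bool
dir zero    k ()
dir (suc m) k u v = go k
  where
  go : ℕ → Bool
  go zero    = false
  go (suc i) = ((toℕ u + suc i) % suc m ≡ᵇ toℕ v) ∨ go i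

Hadj : (n k : ℕ) → Fin n → Fin n → Bool
Hadj n k u v = dir n k u v ∨ dir n k v u

Hadj-sym : ∀ n k u v → Hadj n k u v ≡ Hadj n k v u
Hadj-sym n k u v = ∨-comm (dir n k u v) (dir n k v u)

record SubGraph (n k : ℕ) : Set where
  field
    V     : Fin n → Bool
    E     : Fin n → Fin n → Bool
    E-sym : ∀ u v → E u v ≡ E v u
    E-irr : ∀ u → E u u ≡ false
    E-V   : ∀ u v → E u v ≡ true → V u ≡ true
    E-H   : ∀ u v → E u v ≡ true → Hadj n k u v ≡ true
open SubGraph public

module _ {n k : ℕ} (F : SubGraph n k) where

  ∣_∣ᵥ : ℕ
  ∣_∣ᵥ = count (V F)

  -- reach m u v : there is a walk in F from u to v of length ≤ 2^m
  -- (u ∈ V F; the empty walk counts)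
  reach : ℕ → Fin n → Fin n → Bool
  reach zero    u v = V F u ∧ ((toℕ u ≡ᵇ toℕ v) ∨ E F u v)
  reach (suc m) u v = anyF (λ w → reach m u w ∧ reach m w v)

  -- u and v lie in the same component of F
  -- (walks of length < n ≤ 2^n suffice)
  conn : Fin n → Fin n → Bool
  conn u v = reach n u v

  compSize : Fin n → ℕ
  compSize v = count (conn v)

  -- v is a vertex of F° (its component has more than 2 vertices)
  inCirc : Fin n → Bool
  inCirc v = V F v ∧ (2 <ᵇ compSize v)

  vCirc : ℕ
  vCirc = count inCirc

  -- e(F°) : edges uv (counted once, toℕ u < toℕ v) with u ∈ F°
  -- (then also v ∈ F°, being in the same component)
  eCirc : ℕ
  eCirc = sumF (λ u → count (λ v → inCirc u ∧ E F u v ∧ (toℕ u <ᵇ toℕ v)))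

  -- c(F°) : number of components of F°, counted by their least vertex
  cCirc : ℕ
  cCirc = count (λ v → inCirc v ∧ allF (λ w → not (conn v w) ∨ (toℕ v ≤ᵇ toℕ w)))

  -- γ(F) = e(F°) / (|F°| − 2 c(F°)).  (mkℚᵘ a d denotes a/(d+1).)
  -- Only meaningful when e(F°) > 0, in which case every component of F°
  -- has ≥ 3 vertices, so |F°| − 2c(F°) ≥ 1.
  γ : ℚᵘ
  γ = mkℚᵘ (+ eCirc) ((vCirc ∸ (2 * cCirc)) ∸ 1)

-- H_s : the subgraph of H induced by [s] = {0,…,s−1} (in Fin-labels)

private
  <ᵇ-irr : ∀ m → (m <ᵇ m) ≡ false
  <ᵇ-irr zero    = refl
  <ᵇ-irr (suc zero) = refl
  <ᵇ-irr (suc (suc m)) = <ᵇ-irr (suc m)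

  ∧-l : ∀ a b → (a ∧ b) ≡ true → a ≡ true
  ∧-l true b p = refl

  ∧-r : ∀ a b → (a ∧ b) ≡ true → b ≡ true
  ∧-r true b p = p

  ∨-elim : ∀ {A : Set} a b → (a ≡ true → A) → (b ≡ true → A) → (a ∨ b) ≡ true → A
  ∨-elim true  b f g p = f refl
  ∨-elim false b f g p = g p

module _ (n k s : ℕ) where
  private
    Vs : Fin n → Bool
    Vs u = toℕ u <ᵇ s

    g : Fin n → Fin n → Bool
    g u v = (toℕ u <ᵇ toℕ v) ∧ (Vs u ∧ (Vs v ∧ Hadj n k u v))

    g-irr : ∀ u → g u u ≡ false
    g-irr u rewrite <ᵇ-irr (toℕ u) = refl

  Hs : SubGraph n k
  Hs = record
    { V     = Vs
    ; E     = λ u v → g u v ∨ g v u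
    ; E-sym = λ u v → ∨-comm (g u v) (g v u)
    ; E-irr = λ u → subst (λ b → (b ∨ b) ≡ false) (sym (g-irr u)) refl
    ; E-V   = λ u v → ∨-elim (g u v) (g v u)
                (λ p → ∧-l (Vs u) _ (∧-r (toℕ u <ᵇ toℕ v) _ p))
                (λ p → ∧-l (Vs u) _ (∧-r (Vs v) _ (∧-r (toℕ v <ᵇ toℕ u) _ p)))
    ; E-H   = λ u v → ∨-elim (g u v) (g v u)
                (λ p → ∧-r (Vs v) _ (∧-r (Vs u) _ (∧-r (toℕ u <ᵇ toℕ v) _ p)))
                (λ p → subst (_≡ true) (Hadj-sym n k v u)
                         (∧-r (Vs u) _ (∧-r (Vs v) _ (∧-r (toℕ v <ᵇ toℕ u) _ p))))
    }

-- q is γ(s) = max{ γ(F) : F ⊂ H, |F| = s, e(F°) > 0 }: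
-- the maximum is attained at q and q bounds every such γ(F).

open import Data.Nat using (_<_)
open import Data.Rational.Unnormalised using (_≃_) renaming (_≤_ to _≤ℚ_)

IsGammaOf : (n k s : ℕ) → ℚᵘ → Set
IsGammaOf n k s q =
  Σ (SubGraph n k) (λ F → (∣ F ∣ᵥ ≡ s) × ((0 < eCirc F) × (γ F ≃ q)))
  × ((F : SubGraph n k) → ∣ F ∣ᵥ ≡ s → 0 < eCirc F → γ F ≤ℚ q)

-- Write ∂K for the number of pairs (v, i) with v ∈ K, 1 ≤ i ≤ k and v + i ∉ K (mod n). As 2k < n,
-- counting forward neighbours gives e(H[K]) = k|K| − ∂K, so it suffices that an interval [m] minimises
-- ∂ among m-sets once n > k³. If K contains k consecutive vertices, rotate them to the top of [n]: a
-- vertex outside K with j outside vertices below it then has at least k − j of its k predecessors in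
-- K, so ∂K ≥ Σ_{j < n−m} (k − j) ≥ ∂[m]; likewise, with the roles exchanged, if the complement
-- contains such a window. Otherwise every window meets both K and its complement, whence
-- ∂K ≥ |K| ≥ n/k > k² ≥ ∂[m]. So a component C of F° spans at most e(H_|C|) edges. The increments of
-- m ↦ e(H_m) are non-decreasing and at least 3 from m = 3 on, so e(H_m)/(m − 2) increases with m,
-- and summing e(H_|C|) ≤ e(H_s)(|C| − 2)/(s − 2) over the components (s = |F|) gives γ(F) ≤ γ(H_s).

module Submission where

open import Defs
open import Data.Nat using (ℕ; _≤_; _<_)
open import Data.Product using (Σ; _×_)
open import Data.Rational.Unnormalised using () renaming (_≤_ to _≤ℚ_)

open import Data.Nat
open import Data.Nat.Properties
open import Data.Nat.DivMod using (_%_; m<n⇒m%n≡m; [m+n]%n≡m%n; %-distribˡ-+; m%n%n≡m%n; n%n≡0; m≤n⇒[n∸m]%m≡n%m)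
open import Data.Nat.Tactic.RingSolver using (solve-∀)
open import Data.Bool using (Bool; true; false; _∧_; _∨_; not; T)
open import Data.Bool.Properties using (not-involutive; not-injective; ¬-not) renaming (_≟_ to _≟ᵇ_)
open import Data.Fin using (Fin; toℕ; fromℕ; fromℕ<; inject₁) renaming (zero to fzero; suc to fsuc)
open import Data.Fin.Properties
  using (toℕ<n; toℕ-injective; toℕ-fromℕ; toℕ-fromℕ<; fromℕ<-toℕ; toℕ-inject₁; any?; all?; ¬∀⟶∃¬)
import Data.Fin.Properties as Finₚ
open import Data.Product using (_,_)
open import Data.Sum using (_⊎_; inj₁; inj₂)
open import Data.Empty using (⊥; ⊥-elim)
import Data.Integer as ℤ
open import Data.Integer.Properties using (pos-*)
open import Data.Rational.Unnormalised using (mkℚᵘ; *≤*; *≡*)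
open import Relation.Binary.PropositionalEquality
open import Relation.Binary.Definitions using (tri<; tri≈; tri>)
open import Relation.Nullary using (Dec; yes; no; ¬_)
open import Function using (_∘_)
open import Algebra.Properties.Semiring.Sum +-*-semiring
  using (sum; sum-cong-≗; ∑-comm; ∑-distrib-+; *-distribˡ-sum; *-distribʳ-sum; sum-init-last)

⟦_⟧ : Bool → ℕ
⟦ true ⟧  = 1
⟦ false ⟧ = 0

⟦⟧≤1 : ∀ b → ⟦ b ⟧ ≤ 1
⟦⟧≤1 true  = ≤-refl
⟦⟧≤1 false = z≤n

⟦⟧-mono : ∀ {a b} → (a ≡ true → b ≡ true) → ⟦ a ⟧ ≤ ⟦ b ⟧
⟦⟧-mono {false} _   = z≤n
⟦⟧-mono {true}  a⇒b rewrite a⇒b refl = ≤-refl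

⟦∧⟧ : ∀ a b → ⟦ a ∧ b ⟧ ≡ ⟦ a ⟧ * ⟦ b ⟧
⟦∧⟧ true  b = sym (+-identityʳ ⟦ b ⟧)
⟦∧⟧ false b = refl

⟦⟧+⟦not⟧≡1 : ∀ b → ⟦ b ⟧ + ⟦ not b ⟧ ≡ 1
⟦⟧+⟦not⟧≡1 true  = refl
⟦⟧+⟦not⟧≡1 false = refl

∧-intro : ∀ {a b} → a ≡ true → b ≡ true → (a ∧ b) ≡ true
∧-intro refl refl = refl

∧-elimˡ : ∀ a {b} → (a ∧ b) ≡ true → a ≡ true
∧-elimˡ true _ = refl

∧-elimʳ : ∀ a {b} → (a ∧ b) ≡ true → b ≡ true
∧-elimʳ true p = p

∨-introˡ : ∀ {a} b → a ≡ true → (a ∨ b) ≡ true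
∨-introˡ b refl = refl

∨-introʳ : ∀ a {b} → b ≡ true → (a ∨ b) ≡ true
∨-introʳ true  _ = refl
∨-introʳ false p = p

∨-elim : ∀ a {b} → (a ∨ b) ≡ true → a ≡ true ⊎ b ≡ true
∨-elim true  _ = inj₁ refl
∨-elim false p = inj₂ p

true≢false : ∀ {b} → b ≡ true → b ≡ false → ⊥
true≢false refl ()

≡true-equiv⇒≡ : ∀ {a b} → (a ≡ true → b ≡ true) → (b ≡ true → a ≡ true) → a ≡ b
≡true-equiv⇒≡ {true}  {true}  _ _ = refl
≡true-equiv⇒≡ {true}  {false} f _ = sym (f refl)
≡true-equiv⇒≡ {false} {true}  _ g = g refl
≡true-equiv⇒≡ {false} {false} _ _ = refl

<ᵇ≡true⇒< : ∀ m n → (m <ᵇ n) ≡ true → m < n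
<ᵇ≡true⇒< m n p = <ᵇ⇒< m n (subst T (sym p) _)

<⇒<ᵇ≡true : ∀ {m n} → m < n → (m <ᵇ n) ≡ true
<⇒<ᵇ≡true {m} {n} p = ¬-not (λ q → subst T q (<⇒<ᵇ p))

≥⇒<ᵇ≡false : ∀ {m n} → n ≤ m → (m <ᵇ n) ≡ false
≥⇒<ᵇ≡false {m} {n} p = ¬-not (λ q → <⇒≱ (<ᵇ≡true⇒< m n q) p)

≤ᵇ≡true⇒≤ : ∀ m n → (m ≤ᵇ n) ≡ true → m ≤ n
≤ᵇ≡true⇒≤ m n p = ≤ᵇ⇒≤ m n (subst T (sym p) _)

≤⇒≤ᵇ≡true : ∀ {m n} → m ≤ n → (m ≤ᵇ n) ≡ true
≤⇒≤ᵇ≡true p = ¬-not (λ q → subst T q (≤⇒≤ᵇ p))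

>⇒≤ᵇ≡false : ∀ {m n} → n < m → (m ≤ᵇ n) ≡ false
>⇒≤ᵇ≡false {m} {n} p = ¬-not (λ q → <⇒≱ p (≤ᵇ≡true⇒≤ m n q))

≡ᵇ≡true⇒≡ : ∀ m n → (m ≡ᵇ n) ≡ true → m ≡ n
≡ᵇ≡true⇒≡ m n p = ≡ᵇ⇒≡ m n (subst T (sym p) _)

≡⇒≡ᵇ≡true : ∀ {m n} → m ≡ n → (m ≡ᵇ n) ≡ true
≡⇒≡ᵇ≡true {m} {n} p = ¬-not (λ q → subst T q (≡⇒≡ᵇ m n p))

≢⇒≡ᵇ≡false : ∀ {m n} → m ≢ n → (m ≡ᵇ n) ≡ false
≢⇒≡ᵇ≡false {m} {n} p = ¬-not (λ q → p (≡ᵇ≡true⇒≡ m n q))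

m+[o∸n]≡o∸[n∸m] : ∀ m n o → m ≤ n → n ≤ o → m + (o ∸ n) ≡ o ∸ (n ∸ m)
m+[o∸n]≡o∸[n∸m] zero    n       o       _         _         = refl
m+[o∸n]≡o∸[n∸m] (suc m) (suc n) (suc o) (s≤s m≤n) (s≤s n≤o) =
  trans (cong suc (m+[o∸n]≡o∸[n∸m] m n o m≤n n≤o)) (sym (+-∸-assoc 1 (≤-trans (m∸n≤m n m) n≤o)))

m+suc[n∸suc[m]]≡n : ∀ {m n} → m < n → m + suc (n ∸ suc m) ≡ n
m+suc[n∸suc[m]]≡n {m} {n} m<n = trans (+-suc m (n ∸ suc m)) (m+[n∸m]≡n m<n)

ratio-chain : ∀ (f : ℕ → ℕ) {a b} → (∀ j → j < b → f j * (2 + j) ≤ f (suc j) * (1 + j)) →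
              a ≤ b → f a * (1 + b) ≤ f b * (1 + a)
ratio-chain f {a} {b} step a≤b with m≤n⇒m<n∨m≡n a≤b
... | inj₂ refl = ≤-refl
ratio-chain f {a} {suc b} step _ | inj₁ (s≤s a≤b) = *-cancelʳ-≤ (f a * (2 + b)) (f (suc b) * (1 + a)) (1 + b) (begin
    f a * (2 + b) * (1 + b)
  ≡⟨ swap-last (f a) (2 + b) (1 + b) ⟩
    f a * (1 + b) * (2 + b)
  ≤⟨ *-monoˡ-≤ (2 + b) (ratio-chain f (λ j j<b → step j (m<n⇒m<1+n j<b)) a≤b) ⟩
    f b * (1 + a) * (2 + b)
  ≡⟨ swap-last (f b) (1 + a) (2 + b) ⟩
    f b * (2 + b) * (1 + a)
  ≤⟨ *-monoˡ-≤ (1 + a) (step b ≤-refl) ⟩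
    f (suc b) * (1 + b) * (1 + a)
  ≡⟨ swap-last (f (suc b)) (1 + b) (1 + a) ⟩
    f (suc b) * (1 + a) * (1 + b) ∎)
  where
  open ≤-Reasoning
  swap-last : ∀ x y z → x * y * z ≡ x * z * y
  swap-last x y z = trans (*-assoc x y z) (trans (cong (x *_) (*-comm y z)) (sym (*-assoc x z y)))

m%n≡m∸n : ∀ {m n} .{{_ : NonZero n}} → n ≤ m → m < n + n → m % n ≡ m ∸ n
m%n≡m∸n {m} {n} n≤m m<2n = trans (sym (m≤n⇒[n∸m]%m≡n%m n≤m)) (m<n⇒m%n≡m (m<n+o⇒m∸n<o m n m<2n))

[m%n+o]%n≡[m+o]%n : ∀ m o n .{{_ : NonZero n}} → (m % n + o) % n ≡ (m + o) % n
[m%n+o]%n≡[m+o]%n m o n = begin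
    (m % n + o) % n
  ≡⟨ %-distribˡ-+ (m % n) o n ⟩
    (m % n % n + o % n) % n
  ≡⟨ cong (λ x → (x + o % n) % n) (m%n%n≡m%n m n) ⟩
    (m % n + o % n) % n
  ≡⟨ sym (%-distribˡ-+ m o n) ⟩
    (m + o) % n ∎
  where open ≡-Reasoning

sumBelow : ℕ → (ℕ → ℕ) → ℕ
sumBelow zero    f = 0
sumBelow (suc n) f = sumBelow n f + f n

sumBelow-cong : ∀ n {f g} → (∀ i → i < n → f i ≡ g i) → sumBelow n f ≡ sumBelow n g
sumBelow-cong zero    h = refl
sumBelow-cong (suc n) h = cong₂ _+_ (sumBelow-cong n (λ i i<n → h i (m<n⇒m<1+n i<n))) (h n ≤-refl)

sumBelow-mono : ∀ n {f g} → (∀ i → i < n → f i ≤ g i) → sumBelow n f ≤ sumBelow n g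
sumBelow-mono zero    h = z≤n
sumBelow-mono (suc n) h = +-mono-≤ (sumBelow-mono n (λ i i<n → h i (m<n⇒m<1+n i<n))) (h n ≤-refl)

sumBelow≡sum : ∀ n (f : ℕ → ℕ) → sumBelow n f ≡ sum {n} (λ i → f (toℕ i))
sumBelow≡sum zero    f = refl
sumBelow≡sum (suc n) f = sym (begin
    sum {suc n} (λ i → f (toℕ i))
  ≡⟨ sum-init-last {n} (λ i → f (toℕ i)) ⟩
    sum {n} (λ i → f (toℕ (inject₁ i))) + f (toℕ (fromℕ n))
  ≡⟨ cong₂ _+_ (sum-cong-≗ {n} (λ i → cong f (toℕ-inject₁ i))) (cong f (toℕ-fromℕ n)) ⟩
    sum {n} (λ i → f (toℕ i)) + f n
  ≡⟨ cong (_+ f n) (sym (sumBelow≡sum n f)) ⟩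
    sumBelow (suc n) f ∎)
  where open ≡-Reasoning

sumBelow-distrib-+ : ∀ n (f g : ℕ → ℕ) → sumBelow n (λ i → f i + g i) ≡ sumBelow n f + sumBelow n g
sumBelow-distrib-+ n f g = begin
    sumBelow n (λ i → f i + g i)
  ≡⟨ sumBelow≡sum n _ ⟩
    sum {n} (λ i → f (toℕ i) + g (toℕ i))
  ≡⟨ ∑-distrib-+ {n} (λ i → f (toℕ i)) (λ i → g (toℕ i)) ⟩
    sum {n} (λ i → f (toℕ i)) + sum {n} (λ i → g (toℕ i))
  ≡⟨ sym (cong₂ _+_ (sumBelow≡sum n f) (sumBelow≡sum n g)) ⟩
    sumBelow n f + sumBelow n g ∎
  where open ≡-Reasoning

*-distribˡ-sumBelow : ∀ n c (f : ℕ → ℕ) → c * sumBelow n f ≡ sumBelow n (λ i → c * f i)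
*-distribˡ-sumBelow n c f = begin
    c * sumBelow n f
  ≡⟨ cong (c *_) (sumBelow≡sum n f) ⟩
    c * sum {n} (λ i → f (toℕ i))
  ≡⟨ *-distribˡ-sum {n} c (λ i → f (toℕ i)) ⟩
    sum {n} (λ i → c * f (toℕ i))
  ≡⟨ sym (sumBelow≡sum n _) ⟩
    sumBelow n (λ i → c * f i) ∎
  where open ≡-Reasoning

sumBelow-comm : ∀ a b (f : ℕ → ℕ → ℕ) →
  sumBelow a (λ i → sumBelow b (f i)) ≡ sumBelow b (λ j → sumBelow a (λ i → f i j))
sumBelow-comm a b f = begin
    sumBelow a (λ i → sumBelow b (f i))
  ≡⟨ sumBelow≡sum a _ ⟩
    sum {a} (λ i → sumBelow b (f (toℕ i)))
  ≡⟨ sum-cong-≗ {a} {λ i → sumBelow b (f (toℕ i))} (λ i → sumBelow≡sum b (f (toℕ i))) ⟩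
    sum {a} (λ i → sum {b} (λ j → f (toℕ i) (toℕ j)))
  ≡⟨ ∑-comm {a} {b} (λ i j → f (toℕ i) (toℕ j)) ⟩
    sum {b} (λ j → sum {a} (λ i → f (toℕ i) (toℕ j)))
  ≡⟨ sym (sum-cong-≗ {b} {λ j → sumBelow a (λ i → f i (toℕ j))} (λ j → sumBelow≡sum a (λ i → f i (toℕ j)))) ⟩
    sum {b} (λ j → sumBelow a (λ i → f i (toℕ j)))
  ≡⟨ sym (sumBelow≡sum b _) ⟩
    sumBelow b (λ j → sumBelow a (λ i → f i j)) ∎
  where open ≡-Reasoning

sumBelow-const : ∀ n c → sumBelow n (λ _ → c) ≡ n * c
sumBelow-const zero    c = refl
sumBelow-const (suc n) c = trans (cong (_+ c) (sumBelow-const n c)) (+-comm (n * c) c)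

sumBelow-zero : ∀ n {f} → (∀ i → i < n → f i ≡ 0) → sumBelow n f ≡ 0
sumBelow-zero n h = trans (sumBelow-cong n h) (trans (sumBelow-const n 0) (*-zeroʳ n))

sumBelow-head : ∀ n (f : ℕ → ℕ) → sumBelow (suc n) f ≡ f 0 + sumBelow n (λ i → f (suc i))
sumBelow-head zero    f = +-comm 0 (f 0)
sumBelow-head (suc n) f = trans (cong (_+ f (suc n)) (sumBelow-head n f)) (+-assoc (f 0) _ (f (suc n)))

sumBelow-split : ∀ a b (f : ℕ → ℕ) → sumBelow (a + b) f ≡ sumBelow a f + sumBelow b (λ i → f (a + i))
sumBelow-split a zero    f = trans (cong (λ m → sumBelow m f) (+-identityʳ a)) (sym (+-identityʳ _))
sumBelow-split a (suc b) f = begin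
    sumBelow (a + suc b) f
  ≡⟨ cong (λ m → sumBelow m f) (+-suc a b) ⟩
    sumBelow (a + b) f + f (a + b)
  ≡⟨ cong (_+ f (a + b)) (sumBelow-split a b f) ⟩
    sumBelow a f + sumBelow b (λ i → f (a + i)) + f (a + b)
  ≡⟨ +-assoc (sumBelow a f) _ _ ⟩
    sumBelow a f + sumBelow (suc b) (λ i → f (a + i)) ∎
  where open ≡-Reasoning

sumBelow-monoˡ : ∀ {a b} (f : ℕ → ℕ) → a ≤ b → sumBelow a f ≤ sumBelow b f
sumBelow-monoˡ {a} {b} f a≤b = begin
    sumBelow a f
  ≤⟨ m≤m+n _ _ ⟩
    sumBelow a f + sumBelow (b ∸ a) (λ i → f (a + i))
  ≡⟨ sym (sumBelow-split a (b ∸ a) f) ⟩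
    sumBelow (a + (b ∸ a)) f
  ≡⟨ cong (λ m → sumBelow m f) (m+[n∸m]≡n a≤b) ⟩
    sumBelow b f ∎
  where open ≤-Reasoning

term≤sumBelow : ∀ n (f : ℕ → ℕ) {j} → j < n → f j ≤ sumBelow n f
term≤sumBelow (suc n) f {j} j<1+n with m≤n⇒m<n∨m≡n (s≤s⁻¹ j<1+n)
... | inj₁ j<n  = ≤-trans (term≤sumBelow n f j<n) (m≤m+n _ _)
... | inj₂ refl = m≤n+m (f j) (sumBelow n f)

sumBelow-reverse : ∀ n (f : ℕ → ℕ) → sumBelow n (λ i → f (n ∸ suc i)) ≡ sumBelow n f
sumBelow-reverse zero    f = refl
sumBelow-reverse (suc n) f = begin
    sumBelow (suc n) (λ i → f (suc n ∸ suc i))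
  ≡⟨ sumBelow-head n _ ⟩
    f n + sumBelow n (λ i → f (n ∸ suc i))
  ≡⟨ +-comm (f n) _ ⟩
    sumBelow n (λ i → f (n ∸ suc i)) + f n
  ≡⟨ cong (_+ f n) (sumBelow-reverse n f) ⟩
    sumBelow (suc n) f ∎
  where open ≡-Reasoning

sumBelow-restrict : ∀ {m n} (f : ℕ → ℕ) → m ≤ n → sumBelow n (λ i → ⟦ i <ᵇ m ⟧ * f i) ≡ sumBelow m f
sumBelow-restrict {m} {n} f m≤n = begin
    sumBelow n (λ i → ⟦ i <ᵇ m ⟧ * f i)
  ≡⟨ cong (λ x → sumBelow x (λ i → ⟦ i <ᵇ m ⟧ * f i)) (sym (m+[n∸m]≡n m≤n)) ⟩
    sumBelow (m + (n ∸ m)) (λ i → ⟦ i <ᵇ m ⟧ * f i)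
  ≡⟨ sumBelow-split m (n ∸ m) _ ⟩
    sumBelow m (λ i → ⟦ i <ᵇ m ⟧ * f i) + sumBelow (n ∸ m) (λ i → ⟦ m + i <ᵇ m ⟧ * f (m + i))
  ≡⟨ cong₂ _+_ (sumBelow-cong m (λ i i<m → trans (cong (λ b → ⟦ b ⟧ * f i) (<⇒<ᵇ≡true i<m)) (+-identityʳ (f i))))
               (sumBelow-zero (n ∸ m) (λ i _ → cong (λ b → ⟦ b ⟧ * f (m + i)) (≥⇒<ᵇ≡false (m≤m+n m i)))) ⟩
    sumBelow m f + 0
  ≡⟨ +-identityʳ _ ⟩
    sumBelow m f ∎
  where open ≡-Reasoning

sumBelow-restrict≤ : ∀ n m (f : ℕ → ℕ) → sumBelow n (λ i → ⟦ i <ᵇ m ⟧ * f i) ≤ sumBelow m f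
sumBelow-restrict≤ n m f with ≤-total m n
... | inj₁ m≤n = ≤-reflexive (sumBelow-restrict f m≤n)
... | inj₂ n≤m = ≤-trans (sumBelow-mono n (λ i i<n → ≤-reflexive (trans
                     (cong (λ b → ⟦ b ⟧ * f i) (<⇒<ᵇ≡true (<-≤-trans i<n n≤m))) (+-identityʳ (f i)))))
                   (sumBelow-monoˡ f n≤m)

sumBelow-point : ∀ n p (f : ℕ → ℕ) → sumBelow n (λ i → ⟦ i ≡ᵇ p ⟧ * f i) ≡ ⟦ p <ᵇ n ⟧ * f p
sumBelow-point zero    p f = refl
sumBelow-point (suc n) p f with n ≟ p
... | yes refl = begin
      sumBelow n (λ i → ⟦ i ≡ᵇ n ⟧ * f i) + ⟦ n ≡ᵇ n ⟧ * f n
    ≡⟨ cong₂ _+_ (trans (sumBelow-point n n f) (cong (λ b → ⟦ b ⟧ * f n) (≥⇒<ᵇ≡false (≤-refl {n}))))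
                 (cong (λ b → ⟦ b ⟧ * f n) (≡⇒≡ᵇ≡true {n} refl)) ⟩
      0 + 1 * f n
    ≡⟨ cong (λ b → ⟦ b ⟧ * f n) (sym (<⇒<ᵇ≡true (n<1+n n))) ⟩
      ⟦ n <ᵇ suc n ⟧ * f n ∎
  where open ≡-Reasoning
... | no n≢p = begin
      sumBelow n (λ i → ⟦ i ≡ᵇ p ⟧ * f i) + ⟦ n ≡ᵇ p ⟧ * f n
    ≡⟨ cong₂ _+_ (sumBelow-point n p f) (cong (λ b → ⟦ b ⟧ * f n) (≢⇒≡ᵇ≡false n≢p)) ⟩
      ⟦ p <ᵇ n ⟧ * f p + 0
    ≡⟨ +-identityʳ _ ⟩
      ⟦ p <ᵇ n ⟧ * f p
    ≡⟨ cong (λ b → ⟦ b ⟧ * f p) (≡true-equiv⇒≡ (λ q → <⇒<ᵇ≡true (m<n⇒m<1+n (<ᵇ≡true⇒< p n q)))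
                                                 (λ q → <⇒<ᵇ≡true (≤∧≢⇒< (s≤s⁻¹ (<ᵇ≡true⇒< p (suc n) q)) (n≢p ∘ sym)))) ⟩
      ⟦ p <ᵇ suc n ⟧ * f p ∎
  where open ≡-Reasoning

sumBelow-indicator≤ : ∀ n (f : ℕ → Bool) → sumBelow n (λ i → ⟦ f i ⟧) ≤ n
sumBelow-indicator≤ n f = ≤-trans (sumBelow-mono n (λ i _ → ⟦⟧≤1 (f i)))
                                  (≤-reflexive (trans (sumBelow-const n 1) (*-identityʳ n)))

sumBelow-indicator-not : ∀ n (f : ℕ → Bool) → sumBelow n (λ i → ⟦ f i ⟧) + sumBelow n (λ i → ⟦ not (f i) ⟧) ≡ n
sumBelow-indicator-not n f = begin
    sumBelow n (λ i → ⟦ f i ⟧) + sumBelow n (λ i → ⟦ not (f i) ⟧)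
  ≡⟨ sym (sumBelow-distrib-+ n _ _) ⟩
    sumBelow n (λ i → ⟦ f i ⟧ + ⟦ not (f i) ⟧)
  ≡⟨ sumBelow-cong n (λ i _ → ⟦⟧+⟦not⟧≡1 (f i)) ⟩
    sumBelow n (λ _ → 1)
  ≡⟨ trans (sumBelow-const n 1) (*-identityʳ n) ⟩
    n ∎
  where open ≡-Reasoning

1≤sumBelow-indicator : ∀ n (f : ℕ → Bool) {j} → j < n → f j ≡ true → 1 ≤ sumBelow n (λ i → ⟦ f i ⟧)
1≤sumBelow-indicator n f j<n fj = ≤-trans (≤-reflexive (cong ⟦_⟧ (sym fj))) (term≤sumBelow n (λ i → ⟦ f i ⟧) j<n)

sumBelow-<ᵇ : ∀ n q → sumBelow n (λ i → ⟦ i <ᵇ q ⟧) ≡ n ⊓ q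
sumBelow-<ᵇ zero    q = refl
sumBelow-<ᵇ (suc n) q with n <? q
... | yes n<q rewrite sumBelow-<ᵇ n q | <⇒<ᵇ≡true n<q | m≤n⇒m⊓n≡m (<⇒≤ n<q) | m≤n⇒m⊓n≡m n<q = +-comm n 1
... | no n≮q  rewrite sumBelow-<ᵇ n q | ≥⇒<ᵇ≡false (≮⇒≥ n≮q) | m≥n⇒m⊓n≡n (≮⇒≥ n≮q)
                    | m≥n⇒m⊓n≡n (m≤n⇒m≤1+n (≮⇒≥ n≮q)) = +-identityʳ q

sumBelow-not-<ᵇ : ∀ k q → sumBelow k (λ i → ⟦ not (i <ᵇ q) ⟧) ≡ k ∸ q
sumBelow-not-<ᵇ k q = begin
    sumBelow k (λ i → ⟦ not (i <ᵇ q) ⟧)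
  ≡⟨ sym (m+n∸m≡n (sumBelow k (λ i → ⟦ i <ᵇ q ⟧)) _) ⟩
    sumBelow k (λ i → ⟦ i <ᵇ q ⟧) + sumBelow k (λ i → ⟦ not (i <ᵇ q) ⟧) ∸ sumBelow k (λ i → ⟦ i <ᵇ q ⟧)
  ≡⟨ cong₂ _∸_ (sumBelow-indicator-not k (_<ᵇ q)) (sumBelow-<ᵇ k q) ⟩
    k ∸ (k ⊓ q)
  ≡⟨ ∸-⊓ ⟩
    k ∸ q ∎
  where
  open ≡-Reasoning
  ∸-⊓ : k ∸ (k ⊓ q) ≡ k ∸ q
  ∸-⊓ with ≤-total k q
  ... | inj₁ k≤q rewrite m≤n⇒m⊓n≡m k≤q | n∸n≡0 k = sym (m≤n⇒m∸n≡0 k≤q)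
  ... | inj₂ q≤k rewrite m≥n⇒m⊓n≡n q≤k = refl

sumBelow-rank : ∀ x (f : ℕ → Bool) (g : ℕ → ℕ) →
  sumBelow x (λ w → ⟦ f w ⟧ * g (sumBelow w (λ u → ⟦ f u ⟧))) ≡ sumBelow (sumBelow x (λ u → ⟦ f u ⟧)) g
sumBelow-rank zero    f g = refl
sumBelow-rank (suc x) f g with f x
... | true  rewrite sumBelow-rank x f g | +-identityʳ (g (sumBelow x (λ u → ⟦ f u ⟧)))
                  | +-comm (sumBelow x (λ u → ⟦ f u ⟧)) 1 = refl
... | false rewrite sumBelow-rank x f g | +-identityʳ (sumBelow x (λ u → ⟦ f u ⟧)) = +-identityʳ _

sumBelow-window : ∀ n v k (g : ℕ → ℕ) →
  sumBelow k (λ i → ⟦ v + suc i <ᵇ n ⟧ * g (v + suc i)) ≡ sumBelow n (λ w → ⟦ v <ᵇ w ⟧ * ⟦ w ≤ᵇ v + k ⟧ * g w)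
sumBelow-window n v zero g = sym (sumBelow-zero n (λ w _ → outside w))
  where
  outside : ∀ w → ⟦ v <ᵇ w ⟧ * ⟦ w ≤ᵇ v + 0 ⟧ * g w ≡ 0
  outside w with v <? w
  ... | no  v≮w rewrite ≥⇒<ᵇ≡false (≮⇒≥ v≮w) = refl
  ... | yes v<w rewrite >⇒≤ᵇ≡false (subst (_< w) (sym (+-identityʳ v)) v<w) | *-zeroʳ ⟦ v <ᵇ w ⟧ = refl
sumBelow-window n v (suc k) g = begin
    sumBelow k (λ i → ⟦ v + suc i <ᵇ n ⟧ * g (v + suc i)) + ⟦ last <ᵇ n ⟧ * g last
  ≡⟨ cong₂ _+_ (sumBelow-window n v k g) (sym (sumBelow-point n last g)) ⟩
    sumBelow n (λ w → ⟦ v <ᵇ w ⟧ * ⟦ w ≤ᵇ v + k ⟧ * g w) + sumBelow n (λ w → ⟦ w ≡ᵇ last ⟧ * g w)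
  ≡⟨ sym (sumBelow-distrib-+ n _ _) ⟩
    sumBelow n (λ w → ⟦ v <ᵇ w ⟧ * ⟦ w ≤ᵇ v + k ⟧ * g w + ⟦ w ≡ᵇ last ⟧ * g w)
  ≡⟨ sumBelow-cong n (λ w _ → trans (sym (*-distribʳ-+ (g w) (⟦ v <ᵇ w ⟧ * ⟦ w ≤ᵇ v + k ⟧) _)) (cong (_* g w) (extend w))) ⟩
    sumBelow n (λ w → ⟦ v <ᵇ w ⟧ * ⟦ w ≤ᵇ v + suc k ⟧ * g w) ∎
  where
  open ≡-Reasoning
  last : ℕ
  last = v + suc k
  v+k<last : v + k < last
  v+k<last = subst (v + k <_) (sym (+-suc v k)) (n<1+n (v + k))
  extend : ∀ w → ⟦ v <ᵇ w ⟧ * ⟦ w ≤ᵇ v + k ⟧ + ⟦ w ≡ᵇ last ⟧ ≡ ⟦ v <ᵇ w ⟧ * ⟦ w ≤ᵇ v + suc k ⟧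
  extend w with <-cmp w last
  ... | tri< w<last _ _ rewrite ≢⇒≡ᵇ≡false (<⇒≢ w<last) | ≤⇒≤ᵇ≡true (s≤s⁻¹ (subst (w <_) (+-suc v k) w<last))
                              | ≤⇒≤ᵇ≡true (<⇒≤ w<last) = +-identityʳ _
  ... | tri≈ _ refl _ rewrite ≡⇒≡ᵇ≡true (refl {x = last}) | <⇒<ᵇ≡true (m<m+n v {suc k} z<s)
                              | ≤⇒≤ᵇ≡true (≤-refl {last}) | >⇒≤ᵇ≡false v+k<last = refl
  ... | tri> _ w≢last last<w rewrite ≢⇒≡ᵇ≡false w≢last | >⇒≤ᵇ≡false last<w | >⇒≤ᵇ≡false (<-trans v+k<last last<w)
                                   | *-zeroʳ ⟦ v <ᵇ w ⟧ = refl

sumBelow-window-wrapped : ∀ n v k (g : ℕ → ℕ) → v < n → k ≤ n →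
  sumBelow k (λ i → ⟦ n ≤ᵇ v + suc i ⟧ * g (v + suc i ∸ n)) ≡ sumBelow n (λ u → ⟦ u + n ≤ᵇ v + k ⟧ * g u)
sumBelow-window-wrapped n v zero g v<n _ = sym (sumBelow-zero n (λ u _ →
  cong (λ b → ⟦ b ⟧ * g u) (>⇒≤ᵇ≡false (subst (_< u + n) (sym (+-identityʳ v)) (<-≤-trans v<n (m≤n+m n u))))))
sumBelow-window-wrapped n v (suc k) g v<n 1+k≤n = begin
    sumBelow k (λ i → ⟦ n ≤ᵇ v + suc i ⟧ * g (v + suc i ∸ n)) + ⟦ n ≤ᵇ last ⟧ * g (last ∸ n)
  ≡⟨ cong₂ _+_ (sumBelow-window-wrapped n v k g v<n (<⇒≤ 1+k≤n)) (cong (⟦ n ≤ᵇ last ⟧ *_) (sym pick)) ⟩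
    sumBelow n (λ u → ⟦ u + n ≤ᵇ v + k ⟧ * g u) + ⟦ n ≤ᵇ last ⟧ * sumBelow n (λ u → ⟦ u ≡ᵇ last ∸ n ⟧ * g u)
  ≡⟨ cong (sumBelow n (λ u → ⟦ u + n ≤ᵇ v + k ⟧ * g u) +_) (*-distribˡ-sumBelow n ⟦ n ≤ᵇ last ⟧ _) ⟩
    sumBelow n (λ u → ⟦ u + n ≤ᵇ v + k ⟧ * g u) + sumBelow n (λ u → ⟦ n ≤ᵇ last ⟧ * (⟦ u ≡ᵇ last ∸ n ⟧ * g u))
  ≡⟨ sym (sumBelow-distrib-+ n _ _) ⟩
    sumBelow n (λ u → ⟦ u + n ≤ᵇ v + k ⟧ * g u + ⟦ n ≤ᵇ last ⟧ * (⟦ u ≡ᵇ last ∸ n ⟧ * g u))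
  ≡⟨ sumBelow-cong n (λ u _ → trans (cong (⟦ u + n ≤ᵇ v + k ⟧ * g u +_) (sym (*-assoc ⟦ n ≤ᵇ last ⟧ _ (g u))))
                                    (trans (sym (*-distribʳ-+ (g u) ⟦ u + n ≤ᵇ v + k ⟧ _)) (cong (_* g u) (extend u)))) ⟩
    sumBelow n (λ u → ⟦ u + n ≤ᵇ v + suc k ⟧ * g u) ∎
  where
  open ≡-Reasoning
  last : ℕ
  last = v + suc k
  v+k<last : v + k < last
  v+k<last = subst (v + k <_) (sym (+-suc v k)) (n<1+n (v + k))
  last∸n<n : last ∸ n < n
  last∸n<n = ≤-<-trans (≤-trans (∸-monoˡ-≤ n (+-monoʳ-≤ v 1+k≤n)) (≤-reflexive (m+n∸n≡m v n))) v<n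
  pick : sumBelow n (λ u → ⟦ u ≡ᵇ last ∸ n ⟧ * g u) ≡ g (last ∸ n)
  pick = trans (sumBelow-point n (last ∸ n) g)
               (trans (cong (λ b → ⟦ b ⟧ * g (last ∸ n)) (<⇒<ᵇ≡true last∸n<n)) (+-identityʳ _))
  extend : ∀ u → ⟦ u + n ≤ᵇ v + k ⟧ + ⟦ n ≤ᵇ last ⟧ * ⟦ u ≡ᵇ last ∸ n ⟧ ≡ ⟦ u + n ≤ᵇ v + suc k ⟧
  extend u with <-cmp (u + n) last
  ... | tri< u+n<last _ _ rewrite ≤⇒≤ᵇ≡true (s≤s⁻¹ (subst (u + n <_) (+-suc v k) u+n<last))
        | ≤⇒≤ᵇ≡true (<⇒≤ u+n<last)
        | ≢⇒≡ᵇ≡false (λ (u≡ : u ≡ last ∸ n) → <⇒≱ u+n<last (subst (λ z → last ≤ z + n) (sym u≡)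
                                                   (≤-trans (m≤n+m∸n last n) (≤-reflexive (+-comm n (last ∸ n))))))
        | *-zeroʳ ⟦ n ≤ᵇ last ⟧ = refl
  ... | tri≈ _ u+n≡last _ rewrite >⇒≤ᵇ≡false (subst (v + k <_) (sym u+n≡last) v+k<last)
        | ≤⇒≤ᵇ≡true (subst (n ≤_) u+n≡last (m≤n+m n u))
        | ≡⇒≡ᵇ≡true (sym (trans (cong (_∸ n) (sym u+n≡last)) (m+n∸n≡m u n)))
        | ≤⇒≤ᵇ≡true (≤-reflexive u+n≡last) = refl
  ... | tri> _ _ last<u+n rewrite >⇒≤ᵇ≡false (<-trans v+k<last last<u+n) | >⇒≤ᵇ≡false last<u+n with n ≤? last
  ...   | no  n≰last rewrite >⇒≤ᵇ≡false (≰⇒> n≰last) = refl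
  ...   | yes n≤last rewrite ≤⇒≤ᵇ≡true n≤last
        | ≢⇒≡ᵇ≡false (λ (u≡ : u ≡ last ∸ n) → <⇒≢ last<u+n (sym (trans (cong (_+ n) u≡) (m∸n+n≡m n≤last)))) = refl

sumBelow-rotate-1 : ∀ N (h : ℕ → ℕ) → sumBelow (suc N) (λ i → h ((i + 1) % suc N)) ≡ sumBelow (suc N) h
sumBelow-rotate-1 N h = begin
    sumBelow N (λ i → h ((i + 1) % suc N)) + h ((N + 1) % suc N)
  ≡⟨ cong₂ _+_ (sumBelow-cong N (λ i i<N → cong h (trans (m<n⇒m%n≡m (subst (_< suc N) (+-comm 1 i) (s≤s i<N))) (+-comm i 1))))
               (cong h (trans (cong (_% suc N) (+-comm N 1)) (n%n≡0 (suc N)))) ⟩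
    sumBelow N (λ i → h (suc i)) + h 0
  ≡⟨ +-comm _ (h 0) ⟩
    h 0 + sumBelow N (λ i → h (suc i))
  ≡⟨ sym (sumBelow-head N h) ⟩
    sumBelow (suc N) h ∎
  where open ≡-Reasoning

sumBelow-rotate : ∀ N (h : ℕ → ℕ) c → sumBelow (suc N) (λ i → h ((i + c) % suc N)) ≡ sumBelow (suc N) h
sumBelow-rotate N h zero = sumBelow-cong (suc N) (λ i i<n → cong h (trans (cong (_% suc N) (+-identityʳ i)) (m<n⇒m%n≡m i<n)))
sumBelow-rotate N h (suc c) = begin
    sumBelow (suc N) (λ i → h ((i + suc c) % suc N))
  ≡⟨ sumBelow-cong (suc N) (λ i _ → cong h (trans (cong (_% suc N) (+-suc-assoc i)) (sym ([m%n+o]%n≡[m+o]%n (i + 1) c (suc N))))) ⟩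
    sumBelow (suc N) (λ i → h (((i + 1) % suc N + c) % suc N))
  ≡⟨ sumBelow-rotate-1 N (λ j → h ((j + c) % suc N)) ⟩
    sumBelow (suc N) (λ j → h ((j + c) % suc N))
  ≡⟨ sumBelow-rotate N h c ⟩
    sumBelow (suc N) h ∎
  where
  open ≡-Reasoning
  +-suc-assoc : ∀ i → i + suc c ≡ i + 1 + c
  +-suc-assoc i = trans (+-suc i c) (cong (_+ c) (sym (+-comm i 1)))

sumF≡sum : ∀ {n} (f : Fin n → ℕ) → sumF f ≡ sum f
sumF≡sum {zero}  f = refl
sumF≡sum {suc n} f = cong (f fzero +_) (sumF≡sum (f ∘ fsuc))

count≡sum : ∀ {n} (f : Fin n → Bool) → count f ≡ sum (λ i → ⟦ f i ⟧)
count≡sum {zero}  f = refl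
count≡sum {suc n} f with f fzero
... | true  = cong suc (count≡sum (f ∘ fsuc))
... | false = count≡sum (f ∘ fsuc)

sum-toℕ : ∀ n (g : ℕ → ℕ) → sum {n} (λ i → g (toℕ i)) ≡ sumBelow n g
sum-toℕ n g = sym (sumBelow≡sum n g)

sum-mono : ∀ {n} {f g : Fin n → ℕ} → (∀ i → f i ≤ g i) → sum f ≤ sum g
sum-mono {zero}  h = z≤n
sum-mono {suc n} h = +-mono-≤ (h fzero) (sum-mono (h ∘ fsuc))

sum-zero : ∀ {n} (f : Fin n → ℕ) → (∀ i → f i ≡ 0) → sum f ≡ 0
sum-zero {zero}  f h = refl
sum-zero {suc n} f h = cong₂ _+_ (h fzero) (sum-zero (f ∘ fsuc) (h ∘ fsuc))

count≤ : ∀ {n} (f : Fin n → Bool) → count f ≤ n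
count≤ {zero}  f = z≤n
count≤ {suc n} f with f fzero
... | true  = s≤s (count≤ (f ∘ fsuc))
... | false = m≤n⇒m≤1+n (count≤ (f ∘ fsuc))

count-mono : ∀ {n} (f g : Fin n → Bool) → (∀ i → f i ≡ true → g i ≡ true) → count f ≤ count g
count-mono f g f⊆g = subst₂ _≤_ (sym (count≡sum f)) (sym (count≡sum g)) (sum-mono (λ i → ⟦⟧-mono (f⊆g i)))

count-cong : ∀ {n} (f g : Fin n → Bool) → (∀ i → f i ≡ g i) → count f ≡ count g
count-cong f g f≗g = trans (count≡sum f) (trans (sum-cong-≗ (cong ⟦_⟧ ∘ f≗g)) (sym (count≡sum g)))

count-zero : ∀ {n} (f : Fin n → Bool) → (∀ i → f i ≡ false) → count f ≡ 0
count-zero f h = trans (count≡sum f) (sum-zero _ (cong ⟦_⟧ ∘ h))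

count-single : ∀ {n} (f : Fin n → Bool) j → f j ≡ true → (∀ i → f i ≡ true → i ≡ j) → count f ≡ 1
count-single f fzero fj only rewrite fj =
  cong suc (count-zero (f ∘ fsuc) (λ i → ¬-not (λ fi → Finₚ.0≢1+n (sym (only (fsuc i) fi)))))
count-single f (fsuc j) fj only with f fzero in f0
... | true  = ⊥-elim (Finₚ.0≢1+n (only fzero f0))
... | false = count-single (f ∘ fsuc) j fj (λ i fi → Finₚ.suc-injective (only (fsuc i) fi))

count-strict : ∀ {n} (f g : Fin n → Bool) → (∀ i → f i ≡ true → g i ≡ true) →
               ∀ j → g j ≡ true → f j ≡ false → count f < count g
count-strict f g f⊆g fzero gj fj rewrite gj | fj =
  s≤s (count-mono (f ∘ fsuc) (g ∘ fsuc) (f⊆g ∘ fsuc))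
count-strict f g f⊆g (fsuc j) gj fj with f fzero in f0 | g fzero in g0
... | true  | true  = s≤s (count-strict (f ∘ fsuc) (g ∘ fsuc) (f⊆g ∘ fsuc) j gj fj)
... | true  | false = ⊥-elim (true≢false (f⊆g fzero f0) g0)
... | false | true  = m≤n⇒m≤1+n (count-strict (f ∘ fsuc) (g ∘ fsuc) (f⊆g ∘ fsuc) j gj fj)
... | false | false = count-strict (f ∘ fsuc) (g ∘ fsuc) (f⊆g ∘ fsuc) j gj fj

count-pos : ∀ {n} (f : Fin n → Bool) j → f j ≡ true → 0 < count f
count-pos {n} f j fj = subst (_< count f) (count-zero none (λ _ → refl)) (count-strict none f (λ _ ()) j fj refl)
  where
  none : Fin n → Bool
  none _ = false

anyF-witness : ∀ {n} (f : Fin n → Bool) → anyF f ≡ true → Σ (Fin n) (λ i → f i ≡ true)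
anyF-witness {suc n} f p with f fzero in f0
... | true  = fzero , f0
... | false = let (i , fi) = anyF-witness (f ∘ fsuc) p in fsuc i , fi

anyF-intro : ∀ {n} (f : Fin n → Bool) j → f j ≡ true → anyF f ≡ true
anyF-intro f fzero    fj rewrite fj = refl
anyF-intro f (fsuc j) fj = ∨-introʳ (f fzero) (anyF-intro (f ∘ fsuc) j fj)

allF-elim : ∀ {n} (f : Fin n → Bool) → allF f ≡ true → ∀ i → f i ≡ true
allF-elim f p fzero    = ∧-elimˡ (f fzero) p
allF-elim f p (fsuc i) = allF-elim (f ∘ fsuc) (∧-elimʳ (f fzero) p) i

allF-intro : ∀ {n} (f : Fin n → Bool) → (∀ i → f i ≡ true) → allF f ≡ true
allF-intro {zero}  f h = refl
allF-intro {suc n} f h = ∧-intro (h fzero) (allF-intro (f ∘ fsuc) (h ∘ fsuc))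

allF-counterexample : ∀ {n} (f : Fin n → Bool) → allF f ≡ false → Σ (Fin n) (λ i → f i ≡ false)
allF-counterexample {suc n} f p with f fzero in f0
... | false = fzero , f0
... | true  = let (i , fi) = allF-counterexample (f ∘ fsuc) p in fsuc i , fi

least : ∀ {n} (f : Fin n → Bool) j → f j ≡ true →
        Σ (Fin n) (λ r → (f r ≡ true) × (∀ w → f w ≡ true → toℕ r ≤ toℕ w))
least {suc n} f j fj with f fzero in f0
... | true = fzero , f0 , (λ _ _ → z≤n)
least {suc n} f fzero    fj | false = ⊥-elim (true≢false fj f0)
least {suc n} f (fsuc j) fj | false =
  let (r , fr , r-least) = least (f ∘ fsuc) j fj in fsuc r , fr , shifted r-least
  where
  shifted : ∀ {r} → (∀ w → f (fsuc w) ≡ true → toℕ r ≤ toℕ w) → ∀ w → f w ≡ true → toℕ (fsuc r) ≤ toℕ w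
  shifted r-least fzero    fw = ⊥-elim (true≢false fw f0)
  shifted r-least (fsuc w) fw = s≤s (r-least w fw)

-- Connected components of a subgraph

edgesWithin : (n k : ℕ) → (Fin n → Bool) → ℕ
edgesWithin n k K = sum (λ u → ⟦ K u ⟧ * sum (λ v → ⟦ K v ∧ ((toℕ u <ᵇ toℕ v) ∧ Hadj n k u v) ⟧))

edgesWithin≤eCirc : ∀ {n k} (F : SubGraph n k) (K : Fin n → Bool) →
  (∀ u → K u ≡ true → inCirc F u ≡ true) →
  (∀ u v → K u ≡ true → K v ≡ true → toℕ u < toℕ v → Hadj n k u v ≡ true → E F u v ≡ true) →
  edgesWithin n k K ≤ eCirc F
edgesWithin≤eCirc {n} {k} F K K⊆F° F⊇H[K] = begin
    sum (λ u → ⟦ K u ⟧ * sum (λ v → ⟦ K v ∧ ((toℕ u <ᵇ toℕ v) ∧ Hadj n k u v) ⟧))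
  ≤⟨ sum-mono forward-edges≤ ⟩
    sum (λ u → count (λ v → inCirc F u ∧ (E F u v ∧ (toℕ u <ᵇ toℕ v))))
  ≡⟨ sym (sumF≡sum {n} _) ⟩
    eCirc F ∎
  where
  open ≤-Reasoning
  forward-edges≤ : ∀ u → ⟦ K u ⟧ * sum (λ v → ⟦ K v ∧ ((toℕ u <ᵇ toℕ v) ∧ Hadj n k u v) ⟧)
                       ≤ count (λ v → inCirc F u ∧ (E F u v ∧ (toℕ u <ᵇ toℕ v)))
  forward-edges≤ u with K u in Ku
  ... | false = z≤n
  ... | true  = ≤-trans (≤-reflexive (+-identityʳ _))
                  (subst (_ ≤_) (sym (count≡sum (λ v → inCirc F u ∧ (E F u v ∧ (toℕ u <ᵇ toℕ v)))))
                         (sum-mono (λ v → ⟦⟧-mono (edge v))))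
    where
    edge : ∀ v → (K v ∧ ((toℕ u <ᵇ toℕ v) ∧ Hadj n k u v)) ≡ true →
                 (inCirc F u ∧ (E F u v ∧ (toℕ u <ᵇ toℕ v))) ≡ true
    edge v p = ∧-intro (K⊆F° u Ku) (∧-intro (F⊇H[K] u v Ku Kv (<ᵇ≡true⇒< _ _ u<v) uv) u<v)
      where
      Kv : K v ≡ true
      Kv = ∧-elimˡ (K v) p
      u<v : (toℕ u <ᵇ toℕ v) ≡ true
      u<v = ∧-elimˡ (toℕ u <ᵇ toℕ v) (∧-elimʳ (K v) p)
      uv : Hadj n k u v ≡ true
      uv = ∧-elimʳ (toℕ u <ᵇ toℕ v) (∧-elimʳ (K v) p)

module Components {n k : ℕ} (F : SubGraph n k) where

  hop : Fin n → Fin n → Bool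
  hop = reach F 0

  hop-source : ∀ u v → hop u v ≡ true → V F u ≡ true
  hop-source u v p = ∧-elimˡ (V F u) p

  hop-target : ∀ u v → hop u v ≡ true → V F v ≡ true
  hop-target u v p with ∨-elim (toℕ u ≡ᵇ toℕ v) (∧-elimʳ (V F u) p)
  ... | inj₁ u≡v = subst (λ w → V F w ≡ true) (toℕ-injective (≡ᵇ≡true⇒≡ (toℕ u) (toℕ v) u≡v)) (hop-source u v p)
  ... | inj₂ uv  = E-V F v u (trans (E-sym F v u) uv)

  hop-refl : ∀ u → V F u ≡ true → hop u u ≡ true
  hop-refl u Vu = ∧-intro Vu (∨-introˡ (E F u u) (≡⇒≡ᵇ≡true {toℕ u} refl))

  hop-sym : ∀ u v → hop u v ≡ true → hop v u ≡ true
  hop-sym u v p with ∨-elim (toℕ u ≡ᵇ toℕ v) (∧-elimʳ (V F u) p)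
  ... | inj₁ u≡v =
    ∧-intro (hop-target u v p) (∨-introˡ (E F v u) (≡⇒≡ᵇ≡true (sym (≡ᵇ≡true⇒≡ (toℕ u) (toℕ v) u≡v))))
  ... | inj₂ uv  = ∧-intro (hop-target u v p) (∨-introʳ (toℕ v ≡ᵇ toℕ u) (trans (E-sym F v u) uv))

  edge⇒hop : ∀ u v → E F u v ≡ true → hop u v ≡ true
  edge⇒hop u v uv = ∧-intro (E-V F u v uv) (∨-introʳ (toℕ u ≡ᵇ toℕ v) uv)

  walk : ℕ → Fin n → Fin n → Bool
  walk zero    = hop
  walk (suc ℓ) u v = anyF (λ w → walk ℓ u w ∧ hop w v)

  walk-source : ∀ ℓ u v → walk ℓ u v ≡ true → V F u ≡ true
  walk-source zero    u v p = hop-source u v p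
  walk-source (suc ℓ) u v p = let (w , q) = anyF-witness _ p in walk-source ℓ u w (∧-elimˡ (walk ℓ u w) q)

  walk-target : ∀ ℓ u v → walk ℓ u v ≡ true → V F v ≡ true
  walk-target zero    u v p = hop-target u v p
  walk-target (suc ℓ) u v p = let (w , q) = anyF-witness _ p in hop-target w v (∧-elimʳ (walk ℓ u w) q)

  walk-append : ∀ a b u w v → walk a u w ≡ true → walk b w v ≡ true → walk (b + suc a) u v ≡ true
  walk-append a zero    u w v p q = anyF-intro _ w (∧-intro p q)
  walk-append a (suc b) u w v p q =
    let (x , r) = anyF-witness _ q in
    anyF-intro _ x (∧-intro (walk-append a b u w x p (∧-elimˡ (walk b w x) r)) (∧-elimʳ (walk b w x) r))

  walk-split : ∀ a b u v → walk (b + suc a) u v ≡ true → Σ (Fin n) (λ w → (walk a u w ≡ true) × (walk b w v ≡ true))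
  walk-split a zero u v p =
    let (w , q) = anyF-witness _ p in w , ∧-elimˡ (walk a u w) q , ∧-elimʳ (walk a u w) q
  walk-split a (suc b) u v p =
    let (x , q) = anyF-witness _ p
        (w , uw , wx) = walk-split a b u x (∧-elimˡ (walk (b + suc a) u x) q)
    in w , uw , anyF-intro _ x (∧-intro wx (∧-elimʳ (walk (b + suc a) u x) q))

  walk-extend : ∀ ℓ u v → walk ℓ u v ≡ true → walk (suc ℓ) u v ≡ true
  walk-extend ℓ u v p = anyF-intro _ v (∧-intro p (hop-refl v (walk-target ℓ u v p)))

  walk-mono : ∀ {ℓ ℓ′} u v → ℓ ≤ ℓ′ → walk ℓ u v ≡ true → walk ℓ′ u v ≡ true
  walk-mono {ℓ} {ℓ′} u v ℓ≤ℓ′ p = subst (λ m → walk m u v ≡ true) (m∸n+n≡m ℓ≤ℓ′) (extend* (ℓ′ ∸ ℓ))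
    where
    extend* : ∀ j → walk (j + ℓ) u v ≡ true
    extend* zero    = p
    extend* (suc j) = walk-extend (j + ℓ) u v (extend* j)

  hopBound : ℕ → ℕ
  hopBound zero    = 0
  hopBound (suc m) = hopBound m + suc (hopBound m)

  m≤hopBound : ∀ m → m ≤ hopBound m
  m≤hopBound zero    = z≤n
  m≤hopBound (suc m) = ≤-trans (s≤s (m≤hopBound m)) (m≤n+m _ _)

  reach≡walk : ∀ m u v → reach F m u v ≡ walk (hopBound m) u v
  reach≡walk zero    u v = refl
  reach≡walk (suc m) u v = ≡true-equiv⇒≡ compose decompose
    where
    compose : reach F (suc m) u v ≡ true → walk (hopBound (suc m)) u v ≡ true
    compose p = let (w , q) = anyF-witness _ p in
      walk-append (hopBound m) (hopBound m) u w v (trans (sym (reach≡walk m u w)) (∧-elimˡ (reach F m u w) q))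
                                                  (trans (sym (reach≡walk m w v)) (∧-elimʳ (reach F m u w) q))
    decompose : walk (hopBound (suc m)) u v ≡ true → reach F (suc m) u v ≡ true
    decompose p = let (w , uw , wv) = walk-split (hopBound m) (hopBound m) u v p in
      anyF-intro _ w (∧-intro (trans (reach≡walk m u w) uw) (trans (reach≡walk m w v) wv))

  reach-sym : ∀ m u v → reach F m u v ≡ true → reach F m v u ≡ true
  reach-sym zero    u v p = hop-sym u v p
  reach-sym (suc m) u v p = let (w , q) = anyF-witness _ p in
    anyF-intro _ w (∧-intro (reach-sym m w v (∧-elimʳ (reach F m u w) q)) (reach-sym m u w (∧-elimˡ (reach F m u w) q)))

  Stable : ℕ → Fin n → Set
  Stable ℓ u = ∀ v → walk (suc ℓ) u v ≡ true → walk ℓ u v ≡ true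

  stable-suc : ∀ ℓ u → Stable ℓ u → Stable (suc ℓ) u
  stable-suc ℓ u stable v p = let (w , q) = anyF-witness _ p in
    anyF-intro _ w (∧-intro (stable w (∧-elimˡ (walk (suc ℓ) u w) q)) (∧-elimʳ (walk (suc ℓ) u w) q))

  stable-+ : ∀ ℓ u → Stable ℓ u → ∀ j → Stable (j + ℓ) u
  stable-+ ℓ u stable zero    = stable
  stable-+ ℓ u stable (suc j) = stable-suc (j + ℓ) u (stable-+ ℓ u stable j)

  stable⇒walk-shortens : ∀ ℓ u → Stable ℓ u → ∀ j v → walk (j + ℓ) u v ≡ true → walk ℓ u v ≡ true
  stable⇒walk-shortens ℓ u stable zero    v p = p
  stable⇒walk-shortens ℓ u stable (suc j) v p = stable⇒walk-shortens ℓ u stable j v (stable-+ ℓ u stable j v p)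

  ball-grows-or-stable : ∀ u ℓ → suc ℓ ≤ count (walk ℓ u) ⊎ Stable ℓ u
  ball-grows-or-stable u zero = by-membership (V F u) refl
    where
    by-membership : ∀ b → V F u ≡ b → 1 ≤ count (walk 0 u) ⊎ Stable 0 u
    by-membership true  Vu = inj₁ (count-pos (walk 0 u) u (hop-refl u Vu))
    by-membership false Vu = inj₂ (λ v p → ⊥-elim (true≢false (walk-source 1 u v p) Vu))
  ball-grows-or-stable u (suc ℓ) with ball-grows-or-stable u ℓ | allF (λ v → not (walk (suc ℓ) u v) ∨ walk ℓ u v) in no-new
  ... | inj₂ stable | _ = inj₂ (stable-suc ℓ u stable)
  ... | inj₁ grows | true = inj₂ (stable-suc ℓ u no-new-vertex)
    where
    no-new-vertex : Stable ℓ u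
    no-new-vertex v p with ∨-elim (not (walk (suc ℓ) u v)) (allF-elim _ no-new v)
    ... | inj₁ q  = ⊥-elim (true≢false p (not-injective q))
    ... | inj₂ q  = q
  ... | inj₁ grows | false =
    let (v , new) = allF-counterexample _ no-new in
    inj₁ (≤-trans (s≤s grows) (count-strict (walk ℓ u) (walk (suc ℓ) u) (walk-extend ℓ u) v (reached v new) (unreached v new)))
    where
    reached : ∀ v → (not (walk (suc ℓ) u v) ∨ walk ℓ u v) ≡ false → walk (suc ℓ) u v ≡ true
    reached v q with walk (suc ℓ) u v
    ... | true = refl
    unreached : ∀ v → (not (walk (suc ℓ) u v) ∨ walk ℓ u v) ≡ false → walk ℓ u v ≡ false
    unreached v q with walk (suc ℓ) u v | walk ℓ u v
    ... | true | false = refl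

  stable-at-n : ∀ u → Stable n u
  stable-at-n u with ball-grows-or-stable u n
  ... | inj₁ grows  = ⊥-elim (<⇒≱ grows (count≤ (walk n u)))
  ... | inj₂ stable = stable

  -- conn F allows 2ⁿ hops, but balls stop growing after n rounds, so a concatenation of two such
  -- walks can be shortened back to n hops.
  conn-trans : ∀ u w v → conn F u w ≡ true → conn F w v ≡ true → conn F u v ≡ true
  conn-trans u w v uw wv = trans (reach≡walk n u v) (walk-mono u v (m≤hopBound n) within-n)
    where
    n≤bound : n ≤ hopBound (suc n)
    n≤bound = ≤-trans (n≤1+n n) (m≤hopBound (suc n))
    uv : walk (hopBound (suc n) ∸ n + n) u v ≡ true
    uv = subst (λ m → walk m u v ≡ true) (sym (m∸n+n≡m n≤bound))
               (trans (sym (reach≡walk (suc n) u v)) (anyF-intro _ w (∧-intro uw wv)))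
    within-n : walk n u v ≡ true
    within-n = stable⇒walk-shortens n u (stable-at-n u) (hopBound (suc n) ∸ n) v uv

  conn-sym : ∀ u v → conn F u v ≡ true → conn F v u ≡ true
  conn-sym = reach-sym n

  conn-target : ∀ u v → conn F u v ≡ true → V F v ≡ true
  conn-target u v p = walk-target (hopBound n) u v (trans (sym (reach≡walk n u v)) p)

  hop⇒conn : ∀ u v → hop u v ≡ true → conn F u v ≡ true
  hop⇒conn u v p = trans (reach≡walk n u v) (walk-mono {ℓ′ = hopBound n} u v z≤n p)

  conn-refl : ∀ u → V F u ≡ true → conn F u u ≡ true
  conn-refl u Vu = hop⇒conn u u (hop-refl u Vu)

  compSize-cong : ∀ u v → conn F u v ≡ true → compSize F u ≡ compSize F v
  compSize-cong u v uv = count-cong (conn F u) (conn F v)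
    (λ w → ≡true-equiv⇒≡ (conn-trans v u w (conn-sym u v uv)) (conn-trans u v w uv))

  inCirc-cong : ∀ u v → conn F u v ≡ true → inCirc F u ≡ true → inCirc F v ≡ true
  inCirc-cong u v uv p =
    ∧-intro (conn-target u v uv) (trans (cong (2 <ᵇ_) (sym (compSize-cong u v uv))) (∧-elimʳ (V F u) p))

  IsRoot : Fin n → Bool
  IsRoot ρ = inCirc F ρ ∧ allF (λ w → not (conn F ρ w) ∨ (toℕ ρ ≤ᵇ toℕ w))

  root-least : ∀ ρ w → IsRoot ρ ≡ true → conn F ρ w ≡ true → toℕ ρ ≤ toℕ w
  root-least ρ w root ρw with ∨-elim (not (conn F ρ w)) (allF-elim _ (∧-elimʳ (inCirc F ρ) root) w)
  ... | inj₁ q   = ⊥-elim (true≢false ρw (not-injective q))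
  ... | inj₂ ρ≤w = ≤ᵇ≡true⇒≤ (toℕ ρ) (toℕ w) ρ≤w

  root-inCirc : ∀ ρ v → IsRoot ρ ≡ true → conn F ρ v ≡ true → inCirc F v ≡ true
  root-inCirc ρ v root ρv = inCirc-cong ρ v ρv (∧-elimˡ (inCirc F ρ) root)

  root-exists : ∀ v → inCirc F v ≡ true → Σ (Fin n) (λ ρ → (IsRoot ρ ≡ true) × (conn F ρ v ≡ true))
  root-exists v p =
    let (ρ , vρ , ρ-least) = least (conn F v) v (conn-refl v (∧-elimˡ (V F v) p)) in
    ρ , ∧-intro (inCirc-cong v ρ vρ p) (allF-intro _ (below ρ vρ ρ-least)) , conn-sym v ρ vρ
    where
    below : ∀ ρ → conn F v ρ ≡ true → (∀ w → conn F v w ≡ true → toℕ ρ ≤ toℕ w) →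
            ∀ w → (not (conn F ρ w) ∨ (toℕ ρ ≤ᵇ toℕ w)) ≡ true
    below ρ vρ ρ-least w with conn F ρ w in ρw
    ... | false = refl
    ... | true  = ≤⇒≤ᵇ≡true (ρ-least w (conn-trans v ρ w vρ ρw))

  root-unique : ∀ ρ ρ′ v → IsRoot ρ ≡ true → conn F ρ v ≡ true →
                IsRoot ρ′ ≡ true → conn F ρ′ v ≡ true → ρ ≡ ρ′
  root-unique ρ ρ′ v root ρv root′ ρ′v =
    toℕ-injective (≤-antisym (root-least ρ ρ′ root ρρ′) (root-least ρ′ ρ root′ (conn-sym ρ ρ′ ρρ′)))
    where
    ρρ′ : conn F ρ ρ′ ≡ true
    ρρ′ = conn-trans ρ v ρ′ ρv (conn-sym ρ′ v ρ′v)

  inCirc≡number-of-roots : ∀ v → ⟦ inCirc F v ⟧ ≡ count (λ ρ → IsRoot ρ ∧ conn F ρ v)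
  inCirc≡number-of-roots v with inCirc F v in p
  ... | true  = let (ρ , root , ρv) = root-exists v p in
    sym (count-single _ ρ (∧-intro root ρv)
          (λ ρ′ q → root-unique ρ′ ρ v (∧-elimˡ (IsRoot ρ′) q) (∧-elimʳ (IsRoot ρ′) q) root ρv))
  ... | false = sym (count-zero _ no-root)
    where
    no-root : ∀ ρ → (IsRoot ρ ∧ conn F ρ v) ≡ false
    no-root ρ = ¬-not (λ q → true≢false (root-inCirc ρ v (∧-elimˡ (IsRoot ρ) q) (∧-elimʳ (IsRoot ρ) q)) p)

  sum-over-components : ∀ (g : Fin n → ℕ) →
    sum (λ v → ⟦ inCirc F v ⟧ * g v) ≡ sum (λ ρ → ⟦ IsRoot ρ ⟧ * sum (λ v → ⟦ conn F ρ v ⟧ * g v))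
  sum-over-components g = begin
      sum (λ v → ⟦ inCirc F v ⟧ * g v)
    ≡⟨ sum-cong-≗ {n} (λ v → cong (_* g v) (trans (inCirc≡number-of-roots v) (count≡sum (λ ρ → IsRoot ρ ∧ conn F ρ v)))) ⟩
      sum (λ v → sum (λ ρ → ⟦ IsRoot ρ ∧ conn F ρ v ⟧) * g v)
    ≡⟨ sum-cong-≗ {n} (λ v → *-distribʳ-sum {n} (g v) (λ ρ → ⟦ IsRoot ρ ∧ conn F ρ v ⟧)) ⟩
      sum (λ v → sum (λ ρ → ⟦ IsRoot ρ ∧ conn F ρ v ⟧ * g v))
    ≡⟨ ∑-comm {n} {n} (λ v ρ → ⟦ IsRoot ρ ∧ conn F ρ v ⟧ * g v) ⟩
      sum (λ ρ → sum (λ v → ⟦ IsRoot ρ ∧ conn F ρ v ⟧ * g v))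
    ≡⟨ sum-cong-≗ {n} (λ ρ → trans (sum-cong-≗ {n} (λ v → factor ρ v)) (sym (*-distribˡ-sum {n} ⟦ IsRoot ρ ⟧ _))) ⟩
      sum (λ ρ → ⟦ IsRoot ρ ⟧ * sum (λ v → ⟦ conn F ρ v ⟧ * g v)) ∎
    where
    open ≡-Reasoning
    factor : ∀ ρ v → ⟦ IsRoot ρ ∧ conn F ρ v ⟧ * g v ≡ ⟦ IsRoot ρ ⟧ * (⟦ conn F ρ v ⟧ * g v)
    factor ρ v = trans (cong (_* g v) (⟦∧⟧ (IsRoot ρ) (conn F ρ v))) (*-assoc ⟦ IsRoot ρ ⟧ _ (g v))

  vCirc≡sum-compSize : vCirc F ≡ sum (λ ρ → ⟦ IsRoot ρ ⟧ * compSize F ρ)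
  vCirc≡sum-compSize = begin
      vCirc F
    ≡⟨ count≡sum (inCirc F) ⟩
      sum (λ v → ⟦ inCirc F v ⟧)
    ≡⟨ sum-cong-≗ {n} (λ v → sym (*-identityʳ _)) ⟩
      sum (λ v → ⟦ inCirc F v ⟧ * 1)
    ≡⟨ sum-over-components (λ _ → 1) ⟩
      sum (λ ρ → ⟦ IsRoot ρ ⟧ * sum (λ v → ⟦ conn F ρ v ⟧ * 1))
    ≡⟨ sum-cong-≗ {n} (λ ρ → cong (⟦ IsRoot ρ ⟧ *_)
         (trans (sum-cong-≗ {n} (λ v → *-identityʳ _)) (sym (count≡sum (conn F ρ))))) ⟩
      sum (λ ρ → ⟦ IsRoot ρ ⟧ * compSize F ρ) ∎
    where open ≡-Reasoning

  cCirc≡number-of-roots : cCirc F ≡ sum (λ ρ → ⟦ IsRoot ρ ⟧)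
  cCirc≡number-of-roots = count≡sum IsRoot

  eCirc≤sum-edgesWithin : eCirc F ≤ sum (λ ρ → ⟦ IsRoot ρ ⟧ * edgesWithin n k (conn F ρ))
  eCirc≤sum-edgesWithin = begin
      eCirc F
    ≡⟨ sumF≡sum {n} _ ⟩
      sum (λ u → count (λ v → inCirc F u ∧ (E F u v ∧ (toℕ u <ᵇ toℕ v))))
    ≡⟨ sum-cong-≗ {n} (λ u → trans (count≡sum (λ v → inCirc F u ∧ (E F u v ∧ (toℕ u <ᵇ toℕ v))))
                                   (trans (sum-cong-≗ {n} (λ v → ⟦∧⟧ (inCirc F u) _))
                                          (sym (*-distribˡ-sum {n} ⟦ inCirc F u ⟧ _)))) ⟩
      sum (λ u → ⟦ inCirc F u ⟧ * forwardEdges u)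
    ≡⟨ sum-over-components forwardEdges ⟩
      sum (λ ρ → ⟦ IsRoot ρ ⟧ * sum (λ u → ⟦ conn F ρ u ⟧ * forwardEdges u))
    ≤⟨ sum-mono (λ ρ → *-monoʳ-≤ ⟦ IsRoot ρ ⟧ (sum-mono (forwardEdges≤ ρ))) ⟩
      sum (λ ρ → ⟦ IsRoot ρ ⟧ * edgesWithin n k (conn F ρ)) ∎
    where
    open ≤-Reasoning
    forwardEdges : Fin n → ℕ
    forwardEdges u = sum (λ v → ⟦ E F u v ∧ (toℕ u <ᵇ toℕ v) ⟧)
    forwardEdges≤ : ∀ ρ u → ⟦ conn F ρ u ⟧ * forwardEdges u ≤
                            ⟦ conn F ρ u ⟧ * sum (λ v → ⟦ conn F ρ v ∧ ((toℕ u <ᵇ toℕ v) ∧ Hadj n k u v) ⟧)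
    forwardEdges≤ ρ u with conn F ρ u in ρu
    ... | false = z≤n
    ... | true  = +-monoˡ-≤ 0 (sum-mono (λ v → ⟦⟧-mono (edge v)))
      where
      edge : ∀ v → (E F u v ∧ (toℕ u <ᵇ toℕ v)) ≡ true → (conn F ρ v ∧ ((toℕ u <ᵇ toℕ v) ∧ Hadj n k u v)) ≡ true
      edge v p = ∧-intro (conn-trans ρ u v ρu (hop⇒conn u v (edge⇒hop u v uv))) (∧-intro (∧-elimʳ (E F u v) p) (E-H F u v uv))
        where
        uv : E F u v ≡ true
        uv = ∧-elimˡ (E F u v) p

-- Edge isoperimetry in the k-th power of the cycle

forward : (N k : ℕ) → ℕ → ℕ → Bool
forward N zero    a b = false
forward N (suc i) a b = ((a + suc i) % suc N ≡ᵇ b) ∨ forward N i a b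

forward-witness : ∀ N k a b → forward N k a b ≡ true → Σ ℕ (λ i → (i < k) × ((a + suc i) % suc N ≡ b))
forward-witness N (suc k) a b p with (a + suc k) % suc N ≡ᵇ b in hit
... | true  = k , ≤-refl , ≡ᵇ≡true⇒≡ _ b hit
... | false = let (i , i<k , q) = forward-witness N k a b p in i , m<n⇒m<1+n i<k , q

forward-intro : ∀ N k a b i → i < k → (a + suc i) % suc N ≡ b → forward N k a b ≡ true
forward-intro N (suc k) a b i i<1+k q with (a + suc k) % suc N ≡ᵇ b in hit
... | true  = refl
... | false with m≤n⇒m<n∨m≡n (s≤s⁻¹ i<1+k)
...   | inj₁ i<k  = forward-intro N k a b i i<k q
...   | inj₂ refl = ⊥-elim (true≢false (≡⇒≡ᵇ≡true q) hit)

dir≡forward : ∀ N k (u v : Fin (suc N)) → dir (suc N) k u v ≡ forward N k (toℕ u) (toℕ v)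
dir≡forward N zero    u v = refl
dir≡forward N (suc i) u v = cong (((toℕ u + suc i) % suc N ≡ᵇ toℕ v) ∨_) (dir≡forward N i u v)

-- H on the labels 0, …, N. Vertex sets are predicates on ℕ of which only the values below n matter;
-- 2k < n makes each edge {v, shift v i} arise from a unique pair (v, i).
module Circulant (N k : ℕ) (k+k<n : k + k < suc N) where

  n : ℕ
  n = suc N

  k<n : k < n
  k<n = ≤-trans (s≤s (m≤m+n k k)) k+k<n

  adj : ℕ → ℕ → Bool
  adj a b = forward N k a b ∨ forward N k b a

  size : (ℕ → Bool) → ℕ
  size K = sumBelow n (λ v → ⟦ K v ⟧)

  complement : (ℕ → Bool) → ℕ → Bool
  complement K v = not (K v)

  shift : ℕ → ℕ → ℕ
  shift v i = (v + suc i) % n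

  stays : (ℕ → Bool) → ℕ → ℕ
  stays K i = sumBelow n (λ v → ⟦ K v ∧ K (shift v i) ⟧)

  exits : (ℕ → Bool) → ℕ → ℕ
  exits K i = sumBelow n (λ v → ⟦ K v ∧ not (K (shift v i)) ⟧)

  forwardPairs : (ℕ → Bool) → ℕ
  forwardPairs K = sumBelow k (stays K)

  boundary : (ℕ → Bool) → ℕ
  boundary K = sumBelow k (exits K)

  edgesIn : (ℕ → Bool) → ℕ
  edgesIn K = sumBelow n (λ u → ⟦ K u ⟧ * sumBelow n (λ v → ⟦ K v ∧ ((u <ᵇ v) ∧ adj u v) ⟧))

  initial : ℕ → ℕ → Bool
  initial m v = v <ᵇ m

  rotate : (ℕ → Bool) → ℕ → ℕ → Bool
  rotate K c v = K ((v + c) % n)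

  size-rotate : ∀ K c → size (rotate K c) ≡ size K
  size-rotate K c = sumBelow-rotate N (λ w → ⟦ K w ⟧) c

  size≤n : ∀ K → size K ≤ n
  size≤n K = sumBelow-indicator≤ n K

  size-complement : ∀ K → size (complement K) ≡ n ∸ size K
  size-complement K = sym (trans (cong (_∸ size K) (sym (sumBelow-indicator-not n K))) (m+n∸m≡n (size K) _))

  size-initial : ∀ {m} → m ≤ n → size (initial m) ≡ m
  size-initial {m} m≤n = begin
      sumBelow n (λ v → ⟦ v <ᵇ m ⟧)
    ≡⟨ sumBelow-cong n (λ v _ → sym (*-identityʳ _)) ⟩
      sumBelow n (λ v → ⟦ v <ᵇ m ⟧ * 1)
    ≡⟨ sumBelow-restrict (λ _ → 1) m≤n ⟩
      sumBelow m (λ _ → 1)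
    ≡⟨ trans (sumBelow-const m 1) (*-identityʳ m) ⟩
      m ∎
    where open ≡-Reasoning

  edgesIn-cong : ∀ {K K′} → (∀ v → v < n → K v ≡ K′ v) → edgesIn K ≡ edgesIn K′
  edgesIn-cong {K} {K′} K≗K′ = sumBelow-cong n (λ u u<n → cong₂ _*_ (cong ⟦_⟧ (K≗K′ u u<n))
    (sumBelow-cong n (λ v v<n → cong (λ b → ⟦ b ∧ ((u <ᵇ v) ∧ adj u v) ⟧) (K≗K′ v v<n))))

  stays+exits≡size : ∀ K i → stays K i + exits K i ≡ size K
  stays+exits≡size K i =
    trans (sym (sumBelow-distrib-+ n _ _)) (sumBelow-cong n (λ v _ → split (K v) (K (shift v i))))
    where
    split : ∀ a b → ⟦ a ∧ b ⟧ + ⟦ a ∧ not b ⟧ ≡ ⟦ a ⟧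
    split true  b = ⟦⟧+⟦not⟧≡1 b
    split false b = refl

  forwardPairs+boundary≡k*size : ∀ K → forwardPairs K + boundary K ≡ k * size K
  forwardPairs+boundary≡k*size K = begin
      forwardPairs K + boundary K
    ≡⟨ sym (sumBelow-distrib-+ k _ _) ⟩
      sumBelow k (λ i → stays K i + exits K i)
    ≡⟨ sumBelow-cong k (λ i _ → stays+exits≡size K i) ⟩
      sumBelow k (λ _ → size K)
    ≡⟨ sumBelow-const k (size K) ⟩
      k * size K ∎
    where open ≡-Reasoning

  exits-complement : ∀ K i → exits K i ≡ exits (complement K) i
  exits-complement K i = +-cancelʳ-≡ _ _ _ (begin
      exits K i + stays K i
    ≡⟨ +-comm (exits K i) _ ⟩
      stays K i + exits K i
    ≡⟨ stays+exits≡size K i ⟩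
      size K
    ≡⟨ sym (size-rotate K (suc i)) ⟩
      sumBelow n (λ v → ⟦ K (shift v i) ⟧)
    ≡⟨ sumBelow-cong n (λ v _ → sym (split (K v) (K (shift v i)))) ⟩
      sumBelow n (λ v → ⟦ not (K v) ∧ K (shift v i) ⟧ + ⟦ K v ∧ K (shift v i) ⟧)
    ≡⟨ sumBelow-distrib-+ n _ _ ⟩
      sumBelow n (λ v → ⟦ not (K v) ∧ K (shift v i) ⟧) + stays K i
    ≡⟨ cong (_+ stays K i) (sumBelow-cong n (λ v _ → cong (λ b → ⟦ not (K v) ∧ b ⟧) (sym (not-involutive (K (shift v i)))))) ⟩
      exits (complement K) i + stays K i ∎)
    where
    open ≡-Reasoning
    split : ∀ a b → ⟦ not a ∧ b ⟧ + ⟦ a ∧ b ⟧ ≡ ⟦ b ⟧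
    split true  b = refl
    split false b = +-identityʳ ⟦ b ⟧

  boundary-complement : ∀ K → boundary K ≡ boundary (complement K)
  boundary-complement K = sumBelow-cong k (λ i _ → exits-complement K i)

  exits-rotate : ∀ K c i → exits (rotate K c) i ≡ exits K i
  exits-rotate K c i =
    trans (sumBelow-cong n (λ v _ → cong (λ x → ⟦ K ((v + c) % n) ∧ not (K x) ⟧) (shift-rotate v)))
          (sumBelow-rotate N (λ w → ⟦ K w ∧ not (K (shift w i)) ⟧) c)
    where
    shift-rotate : ∀ v → (shift v i + c) % n ≡ shift ((v + c) % n) i
    shift-rotate v = begin
        ((v + suc i) % n + c) % n
      ≡⟨ [m%n+o]%n≡[m+o]%n (v + suc i) c n ⟩
        (v + suc i + c) % n
      ≡⟨ cong (_% n) (trans (+-assoc v (suc i) c) (trans (cong (v +_) (+-comm (suc i) c)) (sym (+-assoc v c (suc i))))) ⟩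
        (v + c + suc i) % n
      ≡⟨ sym ([m%n+o]%n≡[m+o]%n (v + c) (suc i) n) ⟩
        ((v + c) % n + suc i) % n ∎
      where open ≡-Reasoning

  boundary-rotate : ∀ K c → boundary (rotate K c) ≡ boundary K
  boundary-rotate K c = sumBelow-cong k (λ i _ → exits-rotate K c i)

  unshift : ℕ → ℕ → ℕ
  unshift w i = (w + (n ∸ suc i)) % n

  shift-unshift : ∀ w i → i < k → w < n → shift (unshift w i) i ≡ w
  shift-unshift w i i<k w<n = begin
      ((w + (n ∸ suc i)) % n + suc i) % n
    ≡⟨ [m%n+o]%n≡[m+o]%n (w + (n ∸ suc i)) (suc i) n ⟩
      (w + (n ∸ suc i) + suc i) % n
    ≡⟨ cong (_% n) (trans (+-assoc w _ _) (cong (w +_) (m∸n+n≡m (<-trans i<k k<n)))) ⟩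
      (w + n) % n
    ≡⟨ [m+n]%n≡m%n w n ⟩
      w % n
    ≡⟨ m<n⇒m%n≡m w<n ⟩
      w ∎
    where open ≡-Reasoning

  unshift-inside : ∀ w i → w < n → i < w → unshift w i ≡ w ∸ suc i
  unshift-inside w i w<n i<w = begin
      (w + (n ∸ suc i)) % n
    ≡⟨ cong (_% n) (trans (sym (+-∸-assoc w (<-trans i<w w<n))) (+-∸-comm n i<w)) ⟩
      (w ∸ suc i + n) % n
    ≡⟨ [m+n]%n≡m%n (w ∸ suc i) n ⟩
      (w ∸ suc i) % n
    ≡⟨ m<n⇒m%n≡m (≤-<-trans (m∸n≤m w (suc i)) w<n) ⟩
      w ∸ suc i ∎
    where open ≡-Reasoning

  unshift-wrapped : ∀ w i → i < k → w ≤ i → unshift w i ≡ N ∸ (i ∸ w)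
  unshift-wrapped w i i<k w≤i =
    trans (cong (_% n) (m+[o∸n]≡o∸[n∸m] w i N w≤i (s≤s⁻¹ (<-trans i<k k<n))))
          (m<n⇒m%n≡m (s≤s (m∸n≤m N (i ∸ w))))

  exits-by-target : ∀ K i → i < k → exits K i ≡ sumBelow n (λ w → ⟦ K (unshift w i) ∧ not (K w) ⟧)
  exits-by-target K i i<k = sym (trans
    (sumBelow-cong n (λ w w<n → cong (λ x → ⟦ K (unshift w i) ∧ not (K x) ⟧) (sym (shift-unshift w i i<k w<n))))
    (sumBelow-rotate N (λ v → ⟦ K v ∧ not (K (shift v i)) ⟧) (n ∸ suc i)))

  boundary≡entering : ∀ K → boundary K ≡ sumBelow n (λ w → ⟦ not (K w) ⟧ * sumBelow k (λ i → ⟦ K (unshift w i) ⟧))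
  boundary≡entering K = begin
      sumBelow k (exits K)
    ≡⟨ sumBelow-cong k (λ i i<k → exits-by-target K i i<k) ⟩
      sumBelow k (λ i → sumBelow n (λ w → ⟦ K (unshift w i) ∧ not (K w) ⟧))
    ≡⟨ sumBelow-comm k n _ ⟩
      sumBelow n (λ w → sumBelow k (λ i → ⟦ K (unshift w i) ∧ not (K w) ⟧))
    ≡⟨ sumBelow-cong n (λ w _ → trans (sumBelow-cong k (λ i _ → ⟦∧not⟧ (K (unshift w i)) (K w)))
                                      (sym (*-distribˡ-sumBelow k ⟦ not (K w) ⟧ (λ i → ⟦ K (unshift w i) ⟧)))) ⟩
      sumBelow n (λ w → ⟦ not (K w) ⟧ * sumBelow k (λ i → ⟦ K (unshift w i) ⟧)) ∎
    where
    open ≡-Reasoning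
    ⟦∧not⟧ : ∀ a b → ⟦ a ∧ not b ⟧ ≡ ⟦ not b ⟧ * ⟦ a ⟧
    ⟦∧not⟧ a b = trans (⟦∧⟧ a (not b)) (*-comm ⟦ a ⟧ _)

  boundary≡leaving : ∀ K → boundary K ≡ sumBelow n (λ v → ⟦ K v ⟧ * sumBelow k (λ i → ⟦ not (K (shift v i)) ⟧))
  boundary≡leaving K = begin
      sumBelow k (exits K)
    ≡⟨ sumBelow-comm k n _ ⟩
      sumBelow n (λ v → sumBelow k (λ i → ⟦ K v ∧ not (K (shift v i)) ⟧))
    ≡⟨ sumBelow-cong n (λ v _ → trans (sumBelow-cong k (λ i _ → ⟦∧⟧ (K v) (not (K (shift v i)))))
                                      (sym (*-distribˡ-sumBelow k ⟦ K v ⟧ (λ i → ⟦ not (K (shift v i)) ⟧)))) ⟩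
      sumBelow n (λ v → ⟦ K v ⟧ * sumBelow k (λ i → ⟦ not (K (shift v i)) ⟧)) ∎
    where open ≡-Reasoning

  staircase : ℕ → ℕ
  staircase m = sumBelow m (λ j → k ∸ j)

  staircase≤k*k : ∀ m → staircase m ≤ k * k
  staircase≤k*k m = begin
      sumBelow m (λ j → k ∸ j)
    ≡⟨ sumBelow-cong m (λ j _ → truncate j) ⟩
      sumBelow m (λ j → ⟦ j <ᵇ k ⟧ * (k ∸ j))
    ≤⟨ sumBelow-restrict≤ m k (λ j → k ∸ j) ⟩
      sumBelow k (λ j → k ∸ j)
    ≤⟨ sumBelow-mono k (λ j _ → m∸n≤m k j) ⟩
      sumBelow k (λ _ → k)
    ≡⟨ sumBelow-const k k ⟩
      k * k ∎
    where
    open ≤-Reasoning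
    truncate : ∀ j → k ∸ j ≡ ⟦ j <ᵇ k ⟧ * (k ∸ j)
    truncate j with j <? k
    ... | yes j<k rewrite <⇒<ᵇ≡true j<k = sym (+-identityʳ _)
    ... | no j≮k  rewrite ≥⇒<ᵇ≡false (≮⇒≥ j≮k) = m≤n⇒m∸n≡0 (≮⇒≥ j≮k)

  boundary-initial≤staircase : ∀ {m} → m ≤ n → boundary (initial m) ≤ staircase m
  boundary-initial≤staircase {m} m≤n = begin
      boundary (initial m)
    ≡⟨ boundary≡leaving (initial m) ⟩
      sumBelow n (λ v → ⟦ v <ᵇ m ⟧ * sumBelow k (λ i → ⟦ not (shift v i <ᵇ m) ⟧))
    ≤⟨ sumBelow-mono n (λ v _ → *-monoʳ-≤ ⟦ v <ᵇ m ⟧ (exits≤ v)) ⟩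
      sumBelow n (λ v → ⟦ v <ᵇ m ⟧ * (k ∸ (m ∸ suc v)))
    ≡⟨ sumBelow-restrict (λ v → k ∸ (m ∸ suc v)) m≤n ⟩
      sumBelow m (λ v → k ∸ (m ∸ suc v))
    ≡⟨ sumBelow-reverse m (λ j → k ∸ j) ⟩
      staircase m ∎
    where
    open ≤-Reasoning
    stays-inside : ∀ v i → i < m ∸ suc v → (shift v i <ᵇ m) ≡ true
    stays-inside v i i<gap = <⇒<ᵇ≡true (subst (_< m) (sym (m<n⇒m%n≡m (<-≤-trans v+1+i<m m≤n))) v+1+i<m)
      where
      1+v≤m : suc v ≤ m
      1+v≤m = <⇒≤ (m∸n≢0⇒n<m (λ gap≡0 → n≮0 (subst (i <_) gap≡0 i<gap)))
      v+1+i<m : v + suc i < m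
      v+1+i<m = subst (_≤ m) (cong suc (trans (+-comm i (suc v)) (sym (+-suc v i)))) (m≤o∸n⇒m+n≤o (suc i) 1+v≤m i<gap)
    exits≤ : ∀ v → sumBelow k (λ i → ⟦ not (shift v i <ᵇ m) ⟧) ≤ k ∸ (m ∸ suc v)
    exits≤ v = ≤-trans (sumBelow-mono k pointwise) (≤-reflexive (sumBelow-not-<ᵇ k (m ∸ suc v)))
      where
      pointwise : ∀ i → i < k → ⟦ not (shift v i <ᵇ m) ⟧ ≤ ⟦ not (i <ᵇ m ∸ suc v) ⟧
      pointwise i _ with i <? m ∸ suc v
      ... | no  i≮gap rewrite ≥⇒<ᵇ≡false (≮⇒≥ i≮gap) = ⟦⟧≤1 _
      ... | yes i<gap rewrite <⇒<ᵇ≡true i<gap | stays-inside v i i<gap = z≤n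

  boundary-initial≤staircase-rest : ∀ {m} → m ≤ n → boundary (initial m) ≤ staircase (n ∸ m)
  boundary-initial≤staircase-rest {m} m≤n = begin
      boundary (initial m)
    ≡⟨ boundary≡entering (initial m) ⟩
      sumBelow n (λ w → ⟦ not (w <ᵇ m) ⟧ * sumBelow k (λ i → ⟦ unshift w i <ᵇ m ⟧))
    ≤⟨ sumBelow-mono n entries≤ ⟩
      sumBelow n (λ w → ⟦ not (w <ᵇ m) ⟧ * (k ∸ (w ∸ m)))
    ≡⟨ cong (λ x → sumBelow x (λ w → ⟦ not (w <ᵇ m) ⟧ * (k ∸ (w ∸ m)))) (sym (m+[n∸m]≡n m≤n)) ⟩
      sumBelow (m + (n ∸ m)) (λ w → ⟦ not (w <ᵇ m) ⟧ * (k ∸ (w ∸ m)))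
    ≡⟨ sumBelow-split m (n ∸ m) _ ⟩
      sumBelow m (λ w → ⟦ not (w <ᵇ m) ⟧ * (k ∸ (w ∸ m)))
        + sumBelow (n ∸ m) (λ j → ⟦ not (m + j <ᵇ m) ⟧ * (k ∸ (m + j ∸ m)))
    ≡⟨ cong₂ _+_ (sumBelow-zero m (λ w w<m → cong (λ b → ⟦ not b ⟧ * (k ∸ (w ∸ m))) (<⇒<ᵇ≡true w<m)))
                 (sumBelow-cong (n ∸ m) (λ j _ → trans (cong (λ b → ⟦ not b ⟧ * (k ∸ (m + j ∸ m)))
                                                             (≥⇒<ᵇ≡false (m≤m+n m j)))
                                                       (trans (+-identityʳ _) (cong (k ∸_) (m+n∸m≡n m j))))) ⟩
      staircase (n ∸ m) ∎
    where
    open ≤-Reasoning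
    stays-outside : ∀ w i → w < n → m ≤ w → i < w ∸ m → (unshift w i <ᵇ m) ≡ false
    stays-outside w i w<n m≤w i<gap = ≥⇒<ᵇ≡false (subst (m ≤_) (sym (unshift-inside w i w<n (<-≤-trans i<gap (m∸n≤m w m))))
      (m+n≤o⇒m≤o∸n m (subst (_≤ w) (+-comm (suc i) m) (m≤o∸n⇒m+n≤o (suc i) m≤w i<gap))))
    entries≤ : ∀ w → w < n →
      ⟦ not (w <ᵇ m) ⟧ * sumBelow k (λ i → ⟦ unshift w i <ᵇ m ⟧) ≤ ⟦ not (w <ᵇ m) ⟧ * (k ∸ (w ∸ m))
    entries≤ w w<n with w <? m
    ... | yes w<m rewrite <⇒<ᵇ≡true w<m = z≤n
    ... | no  w≮m = *-monoʳ-≤ ⟦ not (w <ᵇ m) ⟧ (≤-trans (sumBelow-mono k pointwise) (≤-reflexive (sumBelow-not-<ᵇ k (w ∸ m))))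
      where
      pointwise : ∀ i → i < k → ⟦ unshift w i <ᵇ m ⟧ ≤ ⟦ not (i <ᵇ w ∸ m) ⟧
      pointwise i _ with i <? w ∸ m
      ... | no  i≮gap rewrite ≥⇒<ᵇ≡false (≮⇒≥ i≮gap) = ⟦⟧≤1 _
      ... | yes i<gap rewrite <⇒<ᵇ≡true i<gap | stays-outside w i w<n (≮⇒≥ w≮m) i<gap = z≤n

  -- A vertex w ∉ K sees at least k − gapsBelow w of its k predecessors in K: the missing ones
  -- below w are gaps, and those that wrap around land in the window at the top.
  module WindowAtTop (K : ℕ → Bool) (top : ∀ a → a < k → K (N ∸ a) ≡ true) where

    gapsBelow : ℕ → ℕ
    gapsBelow w = sumBelow w (λ u → ⟦ not (K u) ⟧)

    missed-sources≤gapsBelow : ∀ w → w < n → sumBelow k (λ i → ⟦ not (K (unshift w i)) ⟧) ≤ gapsBelow w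
    missed-sources≤gapsBelow w w<n = begin
        sumBelow k (λ i → ⟦ not (K (unshift w i)) ⟧)
      ≤⟨ sumBelow-mono k pointwise ⟩
        sumBelow k (λ i → ⟦ i <ᵇ w ⟧ * ⟦ not (K (w ∸ suc i)) ⟧)
      ≤⟨ sumBelow-restrict≤ k w _ ⟩
        sumBelow w (λ i → ⟦ not (K (w ∸ suc i)) ⟧)
      ≡⟨ sumBelow-reverse w (λ u → ⟦ not (K u) ⟧) ⟩
        gapsBelow w ∎
      where
      open ≤-Reasoning
      pointwise : ∀ i → i < k → ⟦ not (K (unshift w i)) ⟧ ≤ ⟦ i <ᵇ w ⟧ * ⟦ not (K (w ∸ suc i)) ⟧
      pointwise i i<k with i <? w
      ... | yes i<w rewrite <⇒<ᵇ≡true i<w | unshift-inside w i w<n i<w = ≤-reflexive (sym (+-identityʳ _))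
      ... | no  i≮w rewrite unshift-wrapped w i i<k (≮⇒≥ i≮w) | top (i ∸ w) (≤-<-trans (m∸n≤m i w) i<k) = z≤n

    k∸gapsBelow≤sources : ∀ w → w < n → k ∸ gapsBelow w ≤ sumBelow k (λ i → ⟦ K (unshift w i) ⟧)
    k∸gapsBelow≤sources w w<n = begin
        k ∸ gapsBelow w
      ≤⟨ ∸-monoʳ-≤ k (missed-sources≤gapsBelow w w<n) ⟩
        k ∸ missed
      ≡⟨ cong (_∸ missed) (sym (sumBelow-indicator-not k (λ i → K (unshift w i)))) ⟩
        sumBelow k (λ i → ⟦ K (unshift w i) ⟧) + missed ∸ missed
      ≡⟨ m+n∸n≡m (sumBelow k (λ i → ⟦ K (unshift w i) ⟧)) missed ⟩
        sumBelow k (λ i → ⟦ K (unshift w i) ⟧) ∎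
      where
      open ≤-Reasoning
      missed : ℕ
      missed = sumBelow k (λ i → ⟦ not (K (unshift w i)) ⟧)

    staircase-complement≤boundary : staircase (size (complement K)) ≤ boundary K
    staircase-complement≤boundary = begin
        sumBelow (gapsBelow n) (λ j → k ∸ j)
      ≡⟨ sym (sumBelow-rank n (complement K) (λ j → k ∸ j)) ⟩
        sumBelow n (λ w → ⟦ not (K w) ⟧ * (k ∸ gapsBelow w))
      ≤⟨ sumBelow-mono n (λ w w<n → *-monoʳ-≤ ⟦ not (K w) ⟧ (k∸gapsBelow≤sources w w<n)) ⟩
        sumBelow n (λ w → ⟦ not (K w) ⟧ * sumBelow k (λ i → ⟦ K (unshift w i) ⟧))
      ≡⟨ sym (boundary≡entering K) ⟩
        boundary K ∎
      where open ≤-Reasoning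

  Window : (ℕ → Bool) → ℕ → Set
  Window K x = (i : Fin k) → K (shift x (toℕ i)) ≡ true

  window? : ∀ K x → Dec (Window K x)
  window? K x = all? (λ i → K (shift x (toℕ i)) ≟ᵇ true)

  window-top-offset : ∀ a x → a < k → N ∸ a + (x + suc k) ≡ x + suc (k ∸ suc a) + n
  window-top-offset a x a<k = begin
      N ∸ a + (x + suc k)
    ≡⟨ cong (λ z → N ∸ a + (x + suc z)) (sym (m+[n∸m]≡n a<k)) ⟩
      N ∸ a + (x + suc (suc a + (k ∸ suc a)))
    ≡⟨ rearrange (N ∸ a) x a (k ∸ suc a) ⟩
      x + suc (k ∸ suc a) + suc (a + (N ∸ a))
    ≡⟨ cong (λ z → x + suc (k ∸ suc a) + suc z) (m+[n∸m]≡n (s≤s⁻¹ (<-trans a<k k<n))) ⟩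
      x + suc (k ∸ suc a) + n ∎
    where
    open ≡-Reasoning
    rearrange : ∀ d x a b → d + (x + suc (suc a + b)) ≡ x + suc b + suc (a + d)
    rearrange = solve-∀

  window-rotated-to-top : ∀ K x → Window K x → ∀ a → a < k → rotate K (x + suc k) (N ∸ a) ≡ true
  window-rotated-to-top K x win a a<k = begin
      K ((N ∸ a + (x + suc k)) % n)
    ≡⟨ cong (λ z → K (z % n)) (window-top-offset a x a<k) ⟩
      K ((x + suc (k ∸ suc a) + n) % n)
    ≡⟨ cong K ([m+n]%n≡m%n (x + suc (k ∸ suc a)) n) ⟩
      K (shift x (k ∸ suc a))
    ≡⟨ cong (λ i → K (shift x i)) (sym (toℕ-fromℕ< k∸1+a<k)) ⟩
      K (shift x (toℕ (fromℕ< k∸1+a<k)))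
    ≡⟨ win (fromℕ< k∸1+a<k) ⟩
      true ∎
    where
    open ≡-Reasoning
    k∸1+a<k : k ∸ suc a < k
    k∸1+a<k = ∸-monoʳ-< {k} {suc a} {0} z<s a<k

  window⇒staircase-rest≤boundary : ∀ K x → Window K x → staircase (n ∸ size K) ≤ boundary K
  window⇒staircase-rest≤boundary K x win = begin
      staircase (n ∸ size K)
    ≡⟨ cong staircase (sym (trans (size-complement (rotate K c)) (cong (n ∸_) (size-rotate K c)))) ⟩
      staircase (size (complement (rotate K c)))
    ≤⟨ WindowAtTop.staircase-complement≤boundary (rotate K c) (window-rotated-to-top K x win) ⟩
      boundary (rotate K c)
    ≡⟨ boundary-rotate K c ⟩
      boundary K ∎
    where
    open ≤-Reasoning
    c : ℕ
    c = x + suc k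

  Meets : (ℕ → Bool) → Bool → ℕ → Set
  Meets K b x = Σ ℕ (λ i → (i < k) × (K (shift x i) ≡ b))

  no-window⇒meets-false : ∀ K → ¬ Σ (Fin n) (λ x → Window K (toℕ x)) → ∀ x → x < n → Meets K false x
  no-window⇒meets-false K no-window x x<n =
    let (i , Ki≢true) = ¬∀⟶∃¬ k _ (λ i → K (shift x (toℕ i)) ≟ᵇ true) ¬window in toℕ i , toℕ<n i , ¬-not Ki≢true
    where
    ¬window : ¬ Window K x
    ¬window win = no-window (fromℕ< x<n , subst (Window K) (sym (toℕ-fromℕ< x<n)) win)

  size≤boundary : ∀ K → (∀ x → x < n → Meets K false x) → size K ≤ boundary K
  size≤boundary K meets = begin
      sumBelow n (λ v → ⟦ K v ⟧)
    ≡⟨ sumBelow-cong n (λ v _ → sym (*-identityʳ _)) ⟩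
      sumBelow n (λ v → ⟦ K v ⟧ * 1)
    ≤⟨ sumBelow-mono n (λ v v<n → *-monoʳ-≤ ⟦ K v ⟧ (let (i , i<k , Ki) = meets v v<n in
                          1≤sumBelow-indicator k (λ i → not (K (shift v i))) i<k (cong not Ki))) ⟩
      sumBelow n (λ v → ⟦ K v ⟧ * sumBelow k (λ i → ⟦ not (K (shift v i)) ⟧))
    ≡⟨ sym (boundary≡leaving K) ⟩
      boundary K ∎
    where open ≤-Reasoning

  n≤k*size : ∀ K → (∀ x → x < n → Meets K true x) → n ≤ k * size K
  n≤k*size K meets = begin
      n
    ≡⟨ sym (trans (sumBelow-const n 1) (*-identityʳ n)) ⟩
      sumBelow n (λ _ → 1)
    ≤⟨ sumBelow-mono n (λ x x<n → let (i , i<k , Ki) = meets x x<n in 1≤sumBelow-indicator k (λ i → K (shift x i)) i<k Ki) ⟩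
      sumBelow n (λ x → sumBelow k (λ i → ⟦ K (shift x i) ⟧))
    ≡⟨ sumBelow-comm n k _ ⟩
      sumBelow k (λ i → sumBelow n (λ x → ⟦ K (shift x i) ⟧))
    ≡⟨ sumBelow-cong k (λ i _ → size-rotate K (suc i)) ⟩
      sumBelow k (λ _ → size K)
    ≡⟨ sumBelow-const k (size K) ⟩
      k * size K ∎
    where open ≤-Reasoning

  initial-minimises-boundary : k * (k * k) < n → ∀ K → boundary (initial (size K)) ≤ boundary K
  initial-minimises-boundary k³<n K with any? (λ (x : Fin n) → window? K (toℕ x))
  ... | yes (x , win) = ≤-trans (boundary-initial≤staircase-rest (size≤n K)) (window⇒staircase-rest≤boundary K (toℕ x) win)
  ... | no no-window with any? (λ (x : Fin n) → window? (complement K) (toℕ x))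
  ...   | yes (x , win) = begin
      boundary (initial (size K))
    ≤⟨ boundary-initial≤staircase (size≤n K) ⟩
      staircase (size K)
    ≡⟨ cong staircase (sym (trans (cong (n ∸_) (size-complement K)) (m∸[m∸n]≡n (size≤n K)))) ⟩
      staircase (n ∸ size (complement K))
    ≤⟨ window⇒staircase-rest≤boundary (complement K) (toℕ x) win ⟩
      boundary (complement K)
    ≡⟨ sym (boundary-complement K) ⟩
      boundary K ∎
    where open ≤-Reasoning
  ...   | no no-co-window = begin
      boundary (initial (size K))
    ≤⟨ boundary-initial≤staircase (size≤n K) ⟩
      staircase (size K)
    ≤⟨ staircase≤k*k (size K) ⟩
      k * k
    ≤⟨ <⇒≤ (*-cancelˡ-< k (k * k) (size K) (<-≤-trans k³<n (n≤k*size K meets-true))) ⟩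
      size K
    ≤⟨ size≤boundary K (no-window⇒meets-false K no-window) ⟩
      boundary K ∎
    where
    open ≤-Reasoning
    meets-true : ∀ x → x < n → Meets K true x
    meets-true x x<n = let (i , i<k , Ki) = no-window⇒meets-false (complement K) no-co-window x x<n in i , i<k , not-injective Ki

  NearOrWrapped : ℕ → ℕ → Bool
  NearOrWrapped u v = (v ≤ᵇ u + k) ∨ (u + n ≤ᵇ v + k)

  adj⇒near-or-wrapped : ∀ u v → u < v → v < n → adj u v ≡ true → NearOrWrapped u v ≡ true
  adj⇒near-or-wrapped u v u<v v<n p with ∨-elim (forward N k u v) p
  ... | inj₁ uv = let (i , i<k , hit) = forward-witness N k u v uv in ahead i i<k hit
    where
    ahead : ∀ i → i < k → (u + suc i) % n ≡ v → NearOrWrapped u v ≡ true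
    ahead i i<k hit with u + suc i <? n
    ... | yes fits = ∨-introˡ _ (≤⇒≤ᵇ≡true (subst (_≤ u + k) (trans (sym (m<n⇒m%n≡m fits)) hit) (+-monoʳ-≤ u i<k)))
    ... | no  wraps = ⊥-elim (<⇒≱ u<v (subst (_≤ u)
                        (trans (sym (m%n≡m∸n (≮⇒≥ wraps) (+-mono-< (<-trans u<v v<n) (≤-<-trans i<k k<n)))) hit)
                        (≤-trans (∸-monoˡ-≤ n (+-monoʳ-≤ u (<-trans i<k k<n))) (≤-reflexive (m+n∸n≡m u n)))))
  ... | inj₂ vu = let (i , i<k , hit) = forward-witness N k v u vu in behind i i<k hit
    where
    behind : ∀ i → i < k → (v + suc i) % n ≡ u → NearOrWrapped u v ≡ true
    behind i i<k hit with v + suc i <? n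
    ... | yes fits = ⊥-elim (<⇒≱ u<v (subst (v ≤_) (trans (sym (m<n⇒m%n≡m fits)) hit) (m≤m+n v (suc i))))
    ... | no  wraps = ∨-introʳ (v ≤ᵇ u + k) (≤⇒≤ᵇ≡true (subst (_≤ v + k) (sym u+n≡v+1+i) (+-monoʳ-≤ v i<k)))
      where
      u+n≡v+1+i : u + n ≡ v + suc i
      u+n≡v+1+i = trans (cong (_+ n) (sym (trans (sym (m%n≡m∸n (≮⇒≥ wraps) (+-mono-< v<n (≤-<-trans i<k k<n)))) hit)))
                        (m∸n+n≡m (≮⇒≥ wraps))

  near-or-wrapped⇒adj : ∀ u v → u < v → v < n → NearOrWrapped u v ≡ true → adj u v ≡ true
  near-or-wrapped⇒adj u v u<v v<n p with ∨-elim (v ≤ᵇ u + k) p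
  ... | inj₁ near = ∨-introˡ (forward N k v u)
    (forward-intro N k u v (v ∸ suc u) gap<k (trans (cong (_% n) (m+suc[n∸suc[m]]≡n u<v)) (m<n⇒m%n≡m v<n)))
    where
    gap<k : v ∸ suc u < k
    gap<k = +-cancelˡ-≤ u _ _ (subst (_≤ u + k) (sym (m+suc[n∸suc[m]]≡n u<v)) (≤ᵇ≡true⇒≤ v (u + k) near))
  ... | inj₂ wrapped = ∨-introʳ (forward N k u v) (forward-intro N k v u (u + n ∸ suc v) gap<k
    (trans (cong (_% n) (m+suc[n∸suc[m]]≡n v<u+n)) (trans ([m+n]%n≡m%n u n) (m<n⇒m%n≡m (<-trans u<v v<n)))))
    where
    v<u+n : v < u + n
    v<u+n = <-≤-trans v<n (m≤n+m n u)
    gap<k : u + n ∸ suc v < k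
    gap<k = +-cancelˡ-≤ v _ _ (subst (_≤ v + k) (sym (m+suc[n∸suc[m]]≡n v<u+n)) (≤ᵇ≡true⇒≤ (u + n) (v + k) wrapped))

  adj-char : ∀ u v → u < v → v < n → adj u v ≡ NearOrWrapped u v
  adj-char u v u<v v<n = ≡true-equiv⇒≡ (adj⇒near-or-wrapped u v u<v v<n) (near-or-wrapped⇒adj u v u<v v<n)

  near⇒¬wrapped : ∀ u v → v ≤ u + k → v + k < u + n
  near⇒¬wrapped u v v≤u+k = ≤-<-trans (+-monoˡ-≤ k v≤u+k) (subst (_< u + n) (sym (+-assoc u k k)) (+-monoʳ-< u k+k<n))

  ⟦<∧adj⟧≡near+wrapped : ∀ u v → u < n → v < n →
    ⟦ (u <ᵇ v) ∧ adj u v ⟧ ≡ ⟦ u <ᵇ v ⟧ * ⟦ v ≤ᵇ u + k ⟧ + ⟦ u + n ≤ᵇ v + k ⟧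
  ⟦<∧adj⟧≡near+wrapped u v u<n v<n with u <? v
  ... | no  u≮v rewrite ≥⇒<ᵇ≡false (≮⇒≥ u≮v) | >⇒≤ᵇ≡false (+-mono-≤-< (≮⇒≥ u≮v) k<n) = refl
  ... | yes u<v rewrite <⇒<ᵇ≡true u<v | adj-char u v u<v v<n with v ≤? u + k
  ...   | yes near rewrite ≤⇒≤ᵇ≡true near | >⇒≤ᵇ≡false (near⇒¬wrapped u v near) = refl
  ...   | no  far  rewrite >⇒≤ᵇ≡false (≰⇒> far) = refl

  nearPairs : (ℕ → Bool) → ℕ
  nearPairs K = sumBelow n (λ u → ⟦ K u ⟧ * sumBelow n (λ v → ⟦ u <ᵇ v ⟧ * ⟦ v ≤ᵇ u + k ⟧ * ⟦ K v ⟧))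

  wrappedPairs : (ℕ → Bool) → ℕ
  wrappedPairs K = sumBelow n (λ u → ⟦ K u ⟧ * sumBelow n (λ v → ⟦ u + n ≤ᵇ v + k ⟧ * ⟦ K v ⟧))

  edgesIn≡near+wrapped : ∀ K → edgesIn K ≡ nearPairs K + wrappedPairs K
  edgesIn≡near+wrapped K = begin
      edgesIn K
    ≡⟨ sumBelow-cong n (λ u u<n → cong (⟦ K u ⟧ *_) (trans (sumBelow-cong n (λ v v<n → split u v u<n v<n))
                                                           (sumBelow-distrib-+ n _ _))) ⟩
      sumBelow n (λ u → ⟦ K u ⟧ * (sumBelow n (λ v → ⟦ u <ᵇ v ⟧ * ⟦ v ≤ᵇ u + k ⟧ * ⟦ K v ⟧)
                               + sumBelow n (λ v → ⟦ u + n ≤ᵇ v + k ⟧ * ⟦ K v ⟧)))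
    ≡⟨ sumBelow-cong n (λ u _ → *-distribˡ-+ ⟦ K u ⟧ _ _) ⟩
      sumBelow n (λ u → ⟦ K u ⟧ * sumBelow n (λ v → ⟦ u <ᵇ v ⟧ * ⟦ v ≤ᵇ u + k ⟧ * ⟦ K v ⟧)
                  + ⟦ K u ⟧ * sumBelow n (λ v → ⟦ u + n ≤ᵇ v + k ⟧ * ⟦ K v ⟧))
    ≡⟨ sumBelow-distrib-+ n _ _ ⟩
      nearPairs K + wrappedPairs K ∎
    where
    open ≡-Reasoning
    split : ∀ u v → u < n → v < n → ⟦ K v ∧ ((u <ᵇ v) ∧ adj u v) ⟧
          ≡ ⟦ u <ᵇ v ⟧ * ⟦ v ≤ᵇ u + k ⟧ * ⟦ K v ⟧ + ⟦ u + n ≤ᵇ v + k ⟧ * ⟦ K v ⟧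
    split u v u<n v<n = begin
        ⟦ K v ∧ ((u <ᵇ v) ∧ adj u v) ⟧
      ≡⟨ ⟦∧⟧ (K v) _ ⟩
        ⟦ K v ⟧ * ⟦ (u <ᵇ v) ∧ adj u v ⟧
      ≡⟨ cong (⟦ K v ⟧ *_) (⟦<∧adj⟧≡near+wrapped u v u<n v<n) ⟩
        ⟦ K v ⟧ * (⟦ u <ᵇ v ⟧ * ⟦ v ≤ᵇ u + k ⟧ + ⟦ u + n ≤ᵇ v + k ⟧)
      ≡⟨ rearrange ⟦ K v ⟧ (⟦ u <ᵇ v ⟧ * ⟦ v ≤ᵇ u + k ⟧) ⟦ u + n ≤ᵇ v + k ⟧ ⟩
        ⟦ u <ᵇ v ⟧ * ⟦ v ≤ᵇ u + k ⟧ * ⟦ K v ⟧ + ⟦ u + n ≤ᵇ v + k ⟧ * ⟦ K v ⟧ ∎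
      where
      rearrange : ∀ a b c → a * (b + c) ≡ b * a + c * a
      rearrange = solve-∀

  wrappedPairs-swap : ∀ K →
    wrappedPairs K ≡ sumBelow n (λ v → ⟦ K v ⟧ * sumBelow n (λ u → ⟦ u + n ≤ᵇ v + k ⟧ * ⟦ K u ⟧))
  wrappedPairs-swap K = begin
      sumBelow n (λ u → ⟦ K u ⟧ * sumBelow n (λ v → ⟦ u + n ≤ᵇ v + k ⟧ * ⟦ K v ⟧))
    ≡⟨ sumBelow-cong n (λ u _ → *-distribˡ-sumBelow n ⟦ K u ⟧ _) ⟩
      sumBelow n (λ u → sumBelow n (λ v → ⟦ K u ⟧ * (⟦ u + n ≤ᵇ v + k ⟧ * ⟦ K v ⟧)))
    ≡⟨ sumBelow-comm n n _ ⟩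
      sumBelow n (λ v → sumBelow n (λ u → ⟦ K u ⟧ * (⟦ u + n ≤ᵇ v + k ⟧ * ⟦ K v ⟧)))
    ≡⟨ sumBelow-cong n (λ v _ → trans (sumBelow-cong n (λ u _ → rearrange ⟦ K u ⟧ ⟦ u + n ≤ᵇ v + k ⟧ ⟦ K v ⟧))
                                      (sym (*-distribˡ-sumBelow n ⟦ K v ⟧ _))) ⟩
      sumBelow n (λ v → ⟦ K v ⟧ * sumBelow n (λ u → ⟦ u + n ≤ᵇ v + k ⟧ * ⟦ K u ⟧)) ∎
    where
    open ≡-Reasoning
    rearrange : ∀ a b c → a * (b * c) ≡ c * (b * a)
    rearrange = solve-∀

  forwardPairs≡sum-successors : ∀ K → forwardPairs K ≡ sumBelow n (λ v → ⟦ K v ⟧ * sumBelow k (λ i → ⟦ K (shift v i) ⟧))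
  forwardPairs≡sum-successors K = begin
      sumBelow k (stays K)
    ≡⟨ sumBelow-comm k n _ ⟩
      sumBelow n (λ v → sumBelow k (λ i → ⟦ K v ∧ K (shift v i) ⟧))
    ≡⟨ sumBelow-cong n (λ v _ → trans (sumBelow-cong k (λ i _ → ⟦∧⟧ (K v) (K (shift v i))))
                                      (sym (*-distribˡ-sumBelow k ⟦ K v ⟧ (λ i → ⟦ K (shift v i) ⟧)))) ⟩
      sumBelow n (λ v → ⟦ K v ⟧ * sumBelow k (λ i → ⟦ K (shift v i) ⟧)) ∎
    where open ≡-Reasoning

  successors-split : ∀ (K : ℕ → Bool) v → v < n → sumBelow k (λ i → ⟦ K (shift v i) ⟧) ≡
    sumBelow n (λ w → ⟦ v <ᵇ w ⟧ * ⟦ w ≤ᵇ v + k ⟧ * ⟦ K w ⟧)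
      + sumBelow n (λ u → ⟦ u + n ≤ᵇ v + k ⟧ * ⟦ K u ⟧)
  successors-split K v v<n = begin
      sumBelow k (λ i → ⟦ K (shift v i) ⟧)
    ≡⟨ sumBelow-cong k (λ i i<k → unwrap i i<k) ⟩
      sumBelow k (λ i → ⟦ v + suc i <ᵇ n ⟧ * ⟦ K (v + suc i) ⟧ + ⟦ n ≤ᵇ v + suc i ⟧ * ⟦ K (v + suc i ∸ n) ⟧)
    ≡⟨ sumBelow-distrib-+ k _ _ ⟩
      sumBelow k (λ i → ⟦ v + suc i <ᵇ n ⟧ * ⟦ K (v + suc i) ⟧)
        + sumBelow k (λ i → ⟦ n ≤ᵇ v + suc i ⟧ * ⟦ K (v + suc i ∸ n) ⟧)
    ≡⟨ cong₂ _+_ (sumBelow-window n v k (λ w → ⟦ K w ⟧))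
                 (sumBelow-window-wrapped n v k (λ u → ⟦ K u ⟧) v<n (<⇒≤ k<n)) ⟩
      sumBelow n (λ w → ⟦ v <ᵇ w ⟧ * ⟦ w ≤ᵇ v + k ⟧ * ⟦ K w ⟧)
        + sumBelow n (λ u → ⟦ u + n ≤ᵇ v + k ⟧ * ⟦ K u ⟧) ∎
    where
    open ≡-Reasoning
    unwrap : ∀ i → i < k →
      ⟦ K (shift v i) ⟧ ≡ ⟦ v + suc i <ᵇ n ⟧ * ⟦ K (v + suc i) ⟧ + ⟦ n ≤ᵇ v + suc i ⟧ * ⟦ K (v + suc i ∸ n) ⟧
    unwrap i i<k with v + suc i <? n
    ... | yes fits rewrite <⇒<ᵇ≡true fits | >⇒≤ᵇ≡false fits | m<n⇒m%n≡m fits =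
      sym (trans (+-identityʳ (⟦ K (v + suc i) ⟧ + 0)) (+-identityʳ ⟦ K (v + suc i) ⟧))
    ... | no wraps rewrite ≥⇒<ᵇ≡false (≮⇒≥ wraps) | ≤⇒≤ᵇ≡true (≮⇒≥ wraps)
                         | m%n≡m∸n (≮⇒≥ wraps) (+-mono-< v<n (≤-<-trans i<k k<n)) = sym (+-identityʳ ⟦ K (v + suc i ∸ n) ⟧)

  edgesIn≡forwardPairs : ∀ K → edgesIn K ≡ forwardPairs K
  edgesIn≡forwardPairs K = begin
      edgesIn K
    ≡⟨ edgesIn≡near+wrapped K ⟩
      nearPairs K + wrappedPairs K
    ≡⟨ cong (nearPairs K +_) (wrappedPairs-swap K) ⟩
      nearPairs K + sumBelow n (λ v → ⟦ K v ⟧ * sumBelow n (λ u → ⟦ u + n ≤ᵇ v + k ⟧ * ⟦ K u ⟧))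
    ≡⟨ sym (sumBelow-distrib-+ n _ _) ⟩
      sumBelow n (λ v → ⟦ K v ⟧ * sumBelow n (λ w → ⟦ v <ᵇ w ⟧ * ⟦ w ≤ᵇ v + k ⟧ * ⟦ K w ⟧)
                  + ⟦ K v ⟧ * sumBelow n (λ u → ⟦ u + n ≤ᵇ v + k ⟧ * ⟦ K u ⟧))
    ≡⟨ sumBelow-cong n (λ v v<n → trans (sym (*-distribˡ-+ ⟦ K v ⟧ _ _))
                                        (cong (⟦ K v ⟧ *_) (sym (successors-split K v v<n)))) ⟩
      sumBelow n (λ v → ⟦ K v ⟧ * sumBelow k (λ i → ⟦ K (shift v i) ⟧))
    ≡⟨ sym (forwardPairs≡sum-successors K) ⟩
      forwardPairs K ∎
    where open ≡-Reasoning

  edgesIn≡k*size∸boundary : ∀ K → edgesIn K ≡ k * size K ∸ boundary K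
  edgesIn≡k*size∸boundary K = begin
      edgesIn K
    ≡⟨ edgesIn≡forwardPairs K ⟩
      forwardPairs K
    ≡⟨ sym (m+n∸n≡m (forwardPairs K) (boundary K)) ⟩
      forwardPairs K + boundary K ∸ boundary K
    ≡⟨ cong (_∸ boundary K) (forwardPairs+boundary≡k*size K) ⟩
      k * size K ∸ boundary K ∎
    where open ≡-Reasoning

  initial-maximises-edgesIn : k * (k * k) < n → ∀ K → edgesIn K ≤ edgesIn (initial (size K))
  initial-maximises-edgesIn k³<n K = begin
      edgesIn K
    ≡⟨ edgesIn≡k*size∸boundary K ⟩
      k * size K ∸ boundary K
    ≤⟨ ∸-monoʳ-≤ (k * size K) (initial-minimises-boundary k³<n K) ⟩
      k * size K ∸ boundary (initial (size K))
    ≡⟨ cong (λ m → k * m ∸ boundary (initial (size K))) (sym (size-initial (size≤n K))) ⟩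
      k * size (initial (size K)) ∸ boundary (initial (size K))
    ≡⟨ sym (edgesIn≡k*size∸boundary (initial (size K))) ⟩
      edgesIn (initial (size K)) ∎
    where open ≤-Reasoning

  initialEdges : ℕ → ℕ
  initialEdges m = edgesIn (initial m)

  backDegree : ℕ → ℕ
  backDegree j = sumBelow n (λ u → ⟦ u <ᵇ j ⟧ * ⟦ adj u j ⟧)

  initialEdges≡sum-backDegree : ∀ {m} → m ≤ n → initialEdges m ≡ sumBelow m backDegree
  initialEdges≡sum-backDegree {m} m≤n = begin
      sumBelow n (λ u → ⟦ u <ᵇ m ⟧ * sumBelow n (λ v → ⟦ (v <ᵇ m) ∧ ((u <ᵇ v) ∧ adj u v) ⟧))
    ≡⟨ sumBelow-cong n (λ u _ → *-distribˡ-sumBelow n ⟦ u <ᵇ m ⟧ _) ⟩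
      sumBelow n (λ u → sumBelow n (λ v → ⟦ u <ᵇ m ⟧ * ⟦ (v <ᵇ m) ∧ ((u <ᵇ v) ∧ adj u v) ⟧))
    ≡⟨ sumBelow-comm n n _ ⟩
      sumBelow n (λ v → sumBelow n (λ u → ⟦ u <ᵇ m ⟧ * ⟦ (v <ᵇ m) ∧ ((u <ᵇ v) ∧ adj u v) ⟧))
    ≡⟨ sumBelow-cong n (λ v _ → trans (sumBelow-cong n (λ u _ → trans (earlier-endpoint u v)
                                                                       (cong (⟦ v <ᵇ m ⟧ *_) (sym (⟦∧⟧ (u <ᵇ v) _)))))
                                      (sym (*-distribˡ-sumBelow n ⟦ v <ᵇ m ⟧ _))) ⟩
      sumBelow n (λ v → ⟦ v <ᵇ m ⟧ * sumBelow n (λ u → ⟦ (u <ᵇ v) ∧ adj u v ⟧))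
    ≡⟨ sumBelow-restrict _ m≤n ⟩
      sumBelow m (λ v → sumBelow n (λ u → ⟦ (u <ᵇ v) ∧ adj u v ⟧))
    ≡⟨ sumBelow-cong m (λ v _ → sumBelow-cong n (λ u _ → ⟦∧⟧ (u <ᵇ v) (adj u v))) ⟩
      sumBelow m backDegree ∎
    where
    open ≡-Reasoning
    earlier-endpoint : ∀ u v →
      ⟦ u <ᵇ m ⟧ * ⟦ (v <ᵇ m) ∧ ((u <ᵇ v) ∧ adj u v) ⟧ ≡ ⟦ v <ᵇ m ⟧ * (⟦ u <ᵇ v ⟧ * ⟦ adj u v ⟧)
    earlier-endpoint u v with v <? m | u <? v
    ... | no v≮m  | _ rewrite ≥⇒<ᵇ≡false (≮⇒≥ v≮m) = *-zeroʳ ⟦ u <ᵇ m ⟧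
    ... | yes v<m | no u≮v rewrite <⇒<ᵇ≡true v<m | ≥⇒<ᵇ≡false (≮⇒≥ u≮v) = *-zeroʳ ⟦ u <ᵇ m ⟧
    ... | yes v<m | yes u<v rewrite <⇒<ᵇ≡true v<m | <⇒<ᵇ≡true u<v | <⇒<ᵇ≡true (<-trans u<v v<m) =
      sym (+-identityʳ (⟦ adj u v ⟧ + 0))

  initialEdges-suc : ∀ m → m < n → initialEdges (suc m) ≡ initialEdges m + backDegree m
  initialEdges-suc m m<n = trans (initialEdges≡sum-backDegree m<n) (cong (_+ backDegree m) (sym (initialEdges≡sum-backDegree (<⇒≤ m<n))))

  adj-near : ∀ u v → u < v → v ≤ u + k → v < n → adj u v ≡ true
  adj-near u v u<v v≤u+k v<n = near-or-wrapped⇒adj u v u<v v<n (∨-introˡ _ (≤⇒≤ᵇ≡true v≤u+k))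

  forward-step-suc : ∀ a b i → (a + suc i) % n ≡ b → suc b < n → (suc a + suc i) % n ≡ suc b
  forward-step-suc a b i hit 1+b<n = begin
      (suc a + suc i) % n
    ≡⟨ cong (_% n) (+-comm 1 (a + suc i)) ⟩
      (a + suc i + 1) % n
    ≡⟨ sym ([m%n+o]%n≡[m+o]%n (a + suc i) 1 n) ⟩
      ((a + suc i) % n + 1) % n
    ≡⟨ cong (λ z → (z + 1) % n) hit ⟩
      (b + 1) % n
    ≡⟨ cong (_% n) (+-comm b 1) ⟩
      suc b % n
    ≡⟨ m<n⇒m%n≡m 1+b<n ⟩
      suc b ∎
    where open ≡-Reasoning

  adj-suc : ∀ u j → u < j → suc j < n → adj u j ≡ true → adj (suc u) (suc j) ≡ true
  adj-suc u j u<j 1+j<n p with ∨-elim (forward N k u j) p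
  ... | inj₁ uj = let (i , i<k , hit) = forward-witness N k u j uj in
    ∨-introˡ (forward N k (suc j) (suc u)) (forward-intro N k (suc u) (suc j) i i<k (forward-step-suc u j i hit 1+j<n))
  ... | inj₂ ju = let (i , i<k , hit) = forward-witness N k j u ju in
    ∨-introʳ (forward N k (suc u) (suc j)) (forward-intro N k (suc j) (suc u) i i<k (forward-step-suc j u i hit (<-trans (s≤s u<j) 1+j<n)))

  backDegree-suc : ∀ j → suc j < n → backDegree j ≤ backDegree (suc j)
  backDegree-suc j 1+j<n = begin
      sumBelow N (λ u → ⟦ u <ᵇ j ⟧ * ⟦ adj u j ⟧) + ⟦ N <ᵇ j ⟧ * ⟦ adj N j ⟧
    ≡⟨ cong (λ b → sumBelow N (λ u → ⟦ u <ᵇ j ⟧ * ⟦ adj u j ⟧) + ⟦ b ⟧ * ⟦ adj N j ⟧)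
            (≥⇒<ᵇ≡false (s≤s⁻¹ (<⇒≤ 1+j<n))) ⟩
      sumBelow N (λ u → ⟦ u <ᵇ j ⟧ * ⟦ adj u j ⟧) + 0
    ≤⟨ +-mono-≤ (sumBelow-mono N (λ u _ → shifted u)) z≤n ⟩
      sumBelow N (λ u → ⟦ suc u <ᵇ suc j ⟧ * ⟦ adj (suc u) (suc j) ⟧) + ⟦ 0 <ᵇ suc j ⟧ * ⟦ adj 0 (suc j) ⟧
    ≡⟨ +-comm (sumBelow N (λ u → ⟦ suc u <ᵇ suc j ⟧ * ⟦ adj (suc u) (suc j) ⟧)) _ ⟩
      ⟦ 0 <ᵇ suc j ⟧ * ⟦ adj 0 (suc j) ⟧ + sumBelow N (λ u → ⟦ suc u <ᵇ suc j ⟧ * ⟦ adj (suc u) (suc j) ⟧)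
    ≡⟨ sym (sumBelow-head N (λ u → ⟦ u <ᵇ suc j ⟧ * ⟦ adj u (suc j) ⟧)) ⟩
      backDegree (suc j) ∎
    where
    open ≤-Reasoning
    shifted : ∀ u → ⟦ u <ᵇ j ⟧ * ⟦ adj u j ⟧ ≤ ⟦ suc u <ᵇ suc j ⟧ * ⟦ adj (suc u) (suc j) ⟧
    shifted u with u <? j
    ... | no  u≮j rewrite ≥⇒<ᵇ≡false (≮⇒≥ u≮j) = z≤n
    ... | yes u<j with adj u j in uj
    ...   | false rewrite *-zeroʳ ⟦ u <ᵇ j ⟧ = z≤n
    ...   | true  rewrite <⇒<ᵇ≡true u<j | adj-suc u j u<j 1+j<n uj = ≤-refl

  backDegree≤ : ∀ j → backDegree j ≤ j
  backDegree≤ j = begin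
      sumBelow n (λ u → ⟦ u <ᵇ j ⟧ * ⟦ adj u j ⟧)
    ≤⟨ sumBelow-mono n (λ u _ → ≤-trans (*-monoʳ-≤ ⟦ u <ᵇ j ⟧ (⟦⟧≤1 (adj u j))) (≤-reflexive (*-identityʳ _))) ⟩
      sumBelow n (λ u → ⟦ u <ᵇ j ⟧)
    ≡⟨ sumBelow-<ᵇ n j ⟩
      n ⊓ j
    ≤⟨ m⊓n≤n n j ⟩
      j ∎
    where open ≤-Reasoning

  3≤backDegree : 3 ≤ k → ∀ m → 3 ≤ m → m < n → 3 ≤ backDegree m
  3≤backDegree 3≤k m 3≤m m<n = begin
      3
    ≡⟨ sym (sumBelow-cong 3 (λ t t<3 → close-predecessor (m ∸ 3 + t) (below t t<3) (within t))) ⟩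
      sumBelow 3 (λ t → g (m ∸ 3 + t))
    ≤⟨ m≤n+m _ (sumBelow (m ∸ 3) g) ⟩
      sumBelow (m ∸ 3) g + sumBelow 3 (λ t → g (m ∸ 3 + t))
    ≡⟨ sym (sumBelow-split (m ∸ 3) 3 g) ⟩
      sumBelow (m ∸ 3 + 3) g
    ≡⟨ cong (λ z → sumBelow z g) (m∸n+n≡m 3≤m) ⟩
      sumBelow m g
    ≤⟨ sumBelow-monoˡ g (<⇒≤ m<n) ⟩
      backDegree m ∎
    where
    open ≤-Reasoning
    g : ℕ → ℕ
    g u = ⟦ u <ᵇ m ⟧ * ⟦ adj u m ⟧
    close-predecessor : ∀ u → u < m → m ≤ u + k → g u ≡ 1
    close-predecessor u u<m m≤u+k rewrite <⇒<ᵇ≡true u<m | adj-near u m u<m m≤u+k m<n = refl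
    below : ∀ t → t < 3 → m ∸ 3 + t < m
    below t t<3 = subst (m ∸ 3 + t <_) (m∸n+n≡m 3≤m) (+-monoʳ-< (m ∸ 3) t<3)
    within : ∀ t → m ≤ m ∸ 3 + t + k
    within t = subst (_≤ m ∸ 3 + t + k) (m∸n+n≡m 3≤m) (≤-trans (+-monoʳ-≤ (m ∸ 3) 3≤k) (+-monoˡ-≤ k (m≤m+n (m ∸ 3) t)))

  initialEdges≤3+a*backDegree : ∀ a → 3 + a < n → initialEdges (3 + a) ≤ 3 + a * backDegree (3 + a)
  initialEdges≤3+a*backDegree zero 3<n = begin
      initialEdges 3
    ≡⟨ initialEdges≡sum-backDegree (<⇒≤ 3<n) ⟩
      0 + backDegree 0 + backDegree 1 + backDegree 2
    ≤⟨ +-mono-≤ (+-mono-≤ (backDegree≤ 0) (backDegree≤ 1)) (backDegree≤ 2) ⟩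
      3 ∎
    where open ≤-Reasoning
  initialEdges≤3+a*backDegree (suc a) 4+a<n = begin
      initialEdges (4 + a)
    ≡⟨ initialEdges-suc (3 + a) 3+a<n ⟩
      initialEdges (3 + a) + backDegree (3 + a)
    ≤⟨ +-monoˡ-≤ (backDegree (3 + a)) (initialEdges≤3+a*backDegree a 3+a<n) ⟩
      3 + a * backDegree (3 + a) + backDegree (3 + a)
    ≡⟨ +-assoc 3 (a * backDegree (3 + a)) _ ⟩
      3 + (a * backDegree (3 + a) + backDegree (3 + a))
    ≡⟨ cong (3 +_) (+-comm (a * backDegree (3 + a)) _) ⟩
      3 + suc a * backDegree (3 + a)
    ≤⟨ +-monoʳ-≤ 3 (*-monoʳ-≤ (suc a) (backDegree-suc (3 + a) 4+a<n)) ⟩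
      3 + suc a * backDegree (4 + a) ∎
    where
    open ≤-Reasoning
    3+a<n : 3 + a < n
    3+a<n = <-trans (n<1+n _) 4+a<n

  initialEdges≤[1+a]*backDegree : 3 ≤ k → ∀ a → 3 + a < n → initialEdges (3 + a) ≤ (1 + a) * backDegree (3 + a)
  initialEdges≤[1+a]*backDegree 3≤k a 3+a<n = ≤-trans (initialEdges≤3+a*backDegree a 3+a<n)
    (+-monoˡ-≤ (a * backDegree (3 + a)) (3≤backDegree 3≤k (3 + a) (m≤m+n 3 a) 3+a<n))

  initialEdges-ratio-step : 3 ≤ k → ∀ a → 3 + a < n → initialEdges (3 + a) * (2 + a) ≤ initialEdges (4 + a) * (1 + a)
  initialEdges-ratio-step 3≤k a 3+a<n = begin
      initialEdges (3 + a) * (2 + a)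
    ≡⟨ *-suc (initialEdges (3 + a)) (1 + a) ⟩
      initialEdges (3 + a) + initialEdges (3 + a) * (1 + a)
    ≤⟨ +-monoˡ-≤ (initialEdges (3 + a) * (1 + a)) (initialEdges≤[1+a]*backDegree 3≤k a 3+a<n) ⟩
      (1 + a) * backDegree (3 + a) + initialEdges (3 + a) * (1 + a)
    ≡⟨ cong (_+ initialEdges (3 + a) * (1 + a)) (*-comm (1 + a) (backDegree (3 + a))) ⟩
      backDegree (3 + a) * (1 + a) + initialEdges (3 + a) * (1 + a)
    ≡⟨ sym (*-distribʳ-+ (1 + a) (backDegree (3 + a)) (initialEdges (3 + a))) ⟩
      (backDegree (3 + a) + initialEdges (3 + a)) * (1 + a)
    ≡⟨ cong (_* (1 + a)) (trans (+-comm (backDegree (3 + a)) _) (sym (initialEdges-suc (3 + a) 3+a<n))) ⟩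
      initialEdges (4 + a) * (1 + a) ∎
    where open ≤-Reasoning

  initialEdges-ratio-mono : 3 ≤ k → ∀ {m s} → 3 ≤ m → m ≤ s → s ≤ n → initialEdges m * (s ∸ 2) ≤ initialEdges s * (m ∸ 2)
  initialEdges-ratio-mono 3≤k {m} {s} 3≤m m≤s s≤n = subst₂ _≤_
    (cong₂ (λ x y → initialEdges x * y) (m+[n∸m]≡n 3≤m) (sym (+-∸-assoc 1 3≤s)))
    (cong₂ (λ x y → initialEdges x * y) (m+[n∸m]≡n 3≤s) (sym (+-∸-assoc 1 3≤m)))
    (ratio-chain (λ a → initialEdges (3 + a)) step (∸-monoˡ-≤ 3 m≤s))
    where
    3≤s : 3 ≤ s
    3≤s = ≤-trans 3≤m m≤s
    step : ∀ j → j < s ∸ 3 → initialEdges (3 + j) * (2 + j) ≤ initialEdges (3 + suc j) * (1 + j)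
    step j j<s∸3 = initialEdges-ratio-step 3≤k j (<-≤-trans (subst (3 + j <_) (m+[n∸m]≡n 3≤s) (+-monoʳ-< 3 j<s∸3)) s≤n)

-- Density of subgraphs

module Embedding (N k : ℕ) (k+k<n : k + k < suc N) where
  open Circulant N k k+k<n

  lift : (Fin n → Bool) → ℕ → Bool
  lift K i with i <? n
  ... | yes i<n = K (fromℕ< i<n)
  ... | no  _   = false

  lift-toℕ : ∀ K u → lift K (toℕ u) ≡ K u
  lift-toℕ K u with toℕ u <? n
  ... | yes u<n = cong K (fromℕ<-toℕ u u<n)
  ... | no  u≮n = ⊥-elim (u≮n (toℕ<n u))

  Hadj≡adj : ∀ u v → Hadj n k u v ≡ adj (toℕ u) (toℕ v)
  Hadj≡adj u v = cong₂ _∨_ (dir≡forward N k u v) (dir≡forward N k v u)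

  count≡size-lift : ∀ K → count K ≡ size (lift K)
  count≡size-lift K = begin
      count K
    ≡⟨ count≡sum K ⟩
      sum (λ u → ⟦ K u ⟧)
    ≡⟨ sum-cong-≗ {n} (λ u → cong ⟦_⟧ (sym (lift-toℕ K u))) ⟩
      sum {n} (λ u → ⟦ lift K (toℕ u) ⟧)
    ≡⟨ sum-toℕ n (λ i → ⟦ lift K i ⟧) ⟩
      size (lift K) ∎
    where open ≡-Reasoning

  edgesWithin≡edgesIn-lift : ∀ K → edgesWithin n k K ≡ edgesIn (lift K)
  edgesWithin≡edgesIn-lift K = begin
      sum (λ u → ⟦ K u ⟧ * sum (λ v → ⟦ K v ∧ ((toℕ u <ᵇ toℕ v) ∧ Hadj n k u v) ⟧))
    ≡⟨ sum-cong-≗ {n} (λ u → cong₂ _*_ (cong ⟦_⟧ (sym (lift-toℕ K u))) (inner u)) ⟩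
      sum {n} (λ u → ⟦ lift K (toℕ u) ⟧ * sumBelow n (λ j → ⟦ lift K j ∧ ((toℕ u <ᵇ j) ∧ adj (toℕ u) j) ⟧))
    ≡⟨ sum-toℕ n (λ i → ⟦ lift K i ⟧ * sumBelow n (λ j → ⟦ lift K j ∧ ((i <ᵇ j) ∧ adj i j) ⟧)) ⟩
      edgesIn (lift K) ∎
    where
    open ≡-Reasoning
    inner : ∀ u → sum (λ v → ⟦ K v ∧ ((toℕ u <ᵇ toℕ v) ∧ Hadj n k u v) ⟧)
                ≡ sumBelow n (λ j → ⟦ lift K j ∧ ((toℕ u <ᵇ j) ∧ adj (toℕ u) j) ⟧)
    inner u = trans (sum-cong-≗ {n} (λ v → cong ⟦_⟧ (cong₂ _∧_ (sym (lift-toℕ K v))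
                                                             (cong ((toℕ u <ᵇ toℕ v) ∧_) (Hadj≡adj u v)))))
                    (sum-toℕ n (λ j → ⟦ lift K j ∧ ((toℕ u <ᵇ j) ∧ adj (toℕ u) j) ⟧))

  edgesWithin≤initialEdges : k * (k * k) < n → ∀ K → edgesWithin n k K ≤ initialEdges (count K)
  edgesWithin≤initialEdges k³<n K = begin
      edgesWithin n k K
    ≡⟨ edgesWithin≡edgesIn-lift K ⟩
      edgesIn (lift K)
    ≤⟨ initial-maximises-edgesIn k³<n (lift K) ⟩
      initialEdges (size (lift K))
    ≡⟨ cong initialEdges (sym (count≡size-lift K)) ⟩
      initialEdges (count K) ∎
    where open ≤-Reasoning

module DensityBound (N k : ℕ) (k+k<n : k + k < suc N) (k³<n : k * (k * k) < suc N) (3≤k : 3 ≤ k)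
                    (F : SubGraph (suc N) k) where
  open Circulant N k k+k<n
  open Embedding N k k+k<n
  open Components F

  3≤compSize : ∀ ρ → IsRoot ρ ≡ true → 3 ≤ compSize F ρ
  3≤compSize ρ root = <ᵇ≡true⇒< 2 _ (∧-elimʳ (V F ρ) (∧-elimˡ (inCirc F ρ) root))

  compSize≤∣F∣ : ∀ ρ → compSize F ρ ≤ ∣ F ∣ᵥ
  compSize≤∣F∣ ρ = count-mono (conn F ρ) (V F) (conn-target ρ)

  component-bound : ∀ ρ → ⟦ IsRoot ρ ⟧ * edgesWithin n k (conn F ρ) * (∣ F ∣ᵥ ∸ 2)
                        ≤ initialEdges ∣ F ∣ᵥ * (⟦ IsRoot ρ ⟧ * (compSize F ρ ∸ 2))
  component-bound ρ with IsRoot ρ in root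
  ... | false = z≤n
  ... | true  = begin
      (edgesWithin n k (conn F ρ) + 0) * (∣ F ∣ᵥ ∸ 2)
    ≡⟨ cong (_* (∣ F ∣ᵥ ∸ 2)) (+-identityʳ (edgesWithin n k (conn F ρ))) ⟩
      edgesWithin n k (conn F ρ) * (∣ F ∣ᵥ ∸ 2)
    ≤⟨ *-monoˡ-≤ (∣ F ∣ᵥ ∸ 2) (edgesWithin≤initialEdges k³<n (conn F ρ)) ⟩
      initialEdges (compSize F ρ) * (∣ F ∣ᵥ ∸ 2)
    ≤⟨ initialEdges-ratio-mono 3≤k (3≤compSize ρ root) (compSize≤∣F∣ ρ) (count≤ (V F)) ⟩
      initialEdges ∣ F ∣ᵥ * (compSize F ρ ∸ 2)
    ≡⟨ cong (initialEdges ∣ F ∣ᵥ *_) (sym (+-identityʳ (compSize F ρ ∸ 2))) ⟩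
      initialEdges ∣ F ∣ᵥ * (compSize F ρ ∸ 2 + 0) ∎
    where open ≤-Reasoning

  sum-excess≡vCirc∸2*cCirc : sum (λ ρ → ⟦ IsRoot ρ ⟧ * (compSize F ρ ∸ 2)) ≡ vCirc F ∸ 2 * cCirc F
  sum-excess≡vCirc∸2*cCirc = begin
      excess
    ≡⟨ sym (m+n∸n≡m excess (2 * cCirc F)) ⟩
      excess + 2 * cCirc F ∸ 2 * cCirc F
    ≡⟨ cong (λ z → excess + z ∸ 2 * cCirc F)
            (trans (cong (2 *_) cCirc≡number-of-roots) (*-distribˡ-sum {n} 2 (λ ρ → ⟦ IsRoot ρ ⟧))) ⟩
      excess + sum (λ ρ → 2 * ⟦ IsRoot ρ ⟧) ∸ 2 * cCirc F
    ≡⟨ cong (_∸ 2 * cCirc F)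
            (sym (∑-distrib-+ {n} (λ ρ → ⟦ IsRoot ρ ⟧ * (compSize F ρ ∸ 2)) (λ ρ → 2 * ⟦ IsRoot ρ ⟧))) ⟩
      sum (λ ρ → ⟦ IsRoot ρ ⟧ * (compSize F ρ ∸ 2) + 2 * ⟦ IsRoot ρ ⟧) ∸ 2 * cCirc F
    ≡⟨ cong (_∸ 2 * cCirc F) (sum-cong-≗ {n} restore) ⟩
      sum (λ ρ → ⟦ IsRoot ρ ⟧ * compSize F ρ) ∸ 2 * cCirc F
    ≡⟨ cong (_∸ 2 * cCirc F) (sym vCirc≡sum-compSize) ⟩
      vCirc F ∸ 2 * cCirc F ∎
    where
    open ≡-Reasoning
    excess : ℕ
    excess = sum (λ ρ → ⟦ IsRoot ρ ⟧ * (compSize F ρ ∸ 2))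
    restore : ∀ ρ → ⟦ IsRoot ρ ⟧ * (compSize F ρ ∸ 2) + 2 * ⟦ IsRoot ρ ⟧ ≡ ⟦ IsRoot ρ ⟧ * compSize F ρ
    restore ρ with IsRoot ρ in root
    ... | false = refl
    ... | true rewrite +-identityʳ (compSize F ρ ∸ 2) | +-identityʳ (compSize F ρ) =
      m∸n+n≡m (≤-trans (n≤1+n 2) (3≤compSize ρ root))

  eCirc-density-bound : eCirc F * (∣ F ∣ᵥ ∸ 2) ≤ initialEdges ∣ F ∣ᵥ * (vCirc F ∸ 2 * cCirc F)
  eCirc-density-bound = begin
      eCirc F * (∣ F ∣ᵥ ∸ 2)
    ≤⟨ *-monoˡ-≤ (∣ F ∣ᵥ ∸ 2) eCirc≤sum-edgesWithin ⟩
      sum (λ ρ → ⟦ IsRoot ρ ⟧ * edgesWithin n k (conn F ρ)) * (∣ F ∣ᵥ ∸ 2)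
    ≡⟨ *-distribʳ-sum {n} (∣ F ∣ᵥ ∸ 2) (λ ρ → ⟦ IsRoot ρ ⟧ * edgesWithin n k (conn F ρ)) ⟩
      sum (λ ρ → ⟦ IsRoot ρ ⟧ * edgesWithin n k (conn F ρ) * (∣ F ∣ᵥ ∸ 2))
    ≤⟨ sum-mono component-bound ⟩
      sum (λ ρ → initialEdges ∣ F ∣ᵥ * (⟦ IsRoot ρ ⟧ * (compSize F ρ ∸ 2)))
    ≡⟨ sym (*-distribˡ-sum {n} (initialEdges ∣ F ∣ᵥ) (λ ρ → ⟦ IsRoot ρ ⟧ * (compSize F ρ ∸ 2))) ⟩
      initialEdges ∣ F ∣ᵥ * sum (λ ρ → ⟦ IsRoot ρ ⟧ * (compSize F ρ ∸ 2))
    ≡⟨ cong (initialEdges ∣ F ∣ᵥ *_) sum-excess≡vCirc∸2*cCirc ⟩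
      initialEdges ∣ F ∣ᵥ * (vCirc F ∸ 2 * cCirc F) ∎
    where open ≤-Reasoning

  small⇒eCirc≡0 : ∣ F ∣ᵥ < 3 → eCirc F ≡ 0
  small⇒eCirc≡0 ∣F∣<3 = n≤0⇒n≡0 (≤-trans eCirc≤sum-edgesWithin
    (≤-reflexive (sum-zero (λ ρ → ⟦ IsRoot ρ ⟧ * edgesWithin n k (conn F ρ)) no-component)))
    where
    no-component : ∀ ρ → ⟦ IsRoot ρ ⟧ * edgesWithin n k (conn F ρ) ≡ 0
    no-component ρ with IsRoot ρ in root
    ... | false = refl
    ... | true  = ⊥-elim (<⇒≱ ∣F∣<3 (≤-trans (3≤compSize ρ root) (compSize≤∣F∣ ρ)))

module InitialSegment (N k : ℕ) (k+k<n : k + k < suc N) (1≤k : 1 ≤ k) (s : ℕ) (3≤s : 3 ≤ s) (s≤n : s ≤ suc N) where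
  open Circulant N k k+k<n
  open Embedding N k k+k<n
  open Components (Hs n k s)

  Hs-edge : ∀ u v → toℕ u < toℕ v → toℕ v < s → Hadj n k u v ≡ true → E (Hs n k s) u v ≡ true
  Hs-edge u v u<v v<s uv =
    ∨-introˡ _ (∧-intro (<⇒<ᵇ≡true u<v) (∧-intro (<⇒<ᵇ≡true (<-trans u<v v<s)) (∧-intro (<⇒<ᵇ≡true v<s) uv)))

  walk-from-0 : ∀ j → j < s → ∀ u → toℕ u ≡ j → walk j fzero u ≡ true
  walk-from-0 zero    0<s u u≡0 = subst (λ w → walk 0 fzero w ≡ true) (toℕ-injective {i = fzero} {j = u} (sym u≡0))
                                        (hop-refl fzero (<⇒<ᵇ≡true 0<s))
  walk-from-0 (suc j) 1+j<s u u≡1+j = anyF-intro (λ w → walk j fzero w ∧ hop w u) u′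
    (∧-intro (walk-from-0 j j<s u′ (toℕ-fromℕ< j<n))
             (∧-intro (<⇒<ᵇ≡true (subst (_< s) (sym (toℕ-fromℕ< j<n)) j<s))
                      (∨-introʳ (toℕ u′ ≡ᵇ toℕ u) (Hs-edge u′ u u′<u (subst (_< s) (sym u≡1+j) 1+j<s) u′u))))
    where
    j<s : j < s
    j<s = <-trans (n<1+n j) 1+j<s
    j<n : j < n
    j<n = <-≤-trans j<s s≤n
    u′ : Fin n
    u′ = fromℕ< j<n
    u′<u : toℕ u′ < toℕ u
    u′<u = subst₂ _<_ (sym (toℕ-fromℕ< j<n)) (sym u≡1+j) (n<1+n j)
    u′u : Hadj n k u′ u ≡ true
    u′u = trans (Hadj≡adj u′ u) (adj-near (toℕ u′) (toℕ u) u′<u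
            (subst₂ _≤_ (sym u≡1+j) (cong (_+ k) (sym (toℕ-fromℕ< j<n))) (subst (suc j ≤_) (+-comm k j) (+-monoˡ-≤ j 1≤k)))
            (toℕ<n u))

  conn-from-0 : ∀ u → toℕ u < s → conn (Hs n k s) fzero u ≡ true
  conn-from-0 u u<s = trans (reach≡walk n fzero u)
    (walk-mono fzero u (≤-trans (<⇒≤ (<-≤-trans u<s s≤n)) (m≤hopBound n)) (walk-from-0 (toℕ u) u<s u refl))

  conn-Hs : ∀ u w → toℕ u < s → conn (Hs n k s) u w ≡ (toℕ w <ᵇ s)
  conn-Hs u w u<s = ≡true-equiv⇒≡ (conn-target u w)
    (λ w<s → conn-trans u fzero w (conn-sym fzero u (conn-from-0 u u<s)) (conn-from-0 w (<ᵇ≡true⇒< _ _ w<s)))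

  ∣Hs∣≡s : ∣ Hs n k s ∣ᵥ ≡ s
  ∣Hs∣≡s = begin
      count (λ (w : Fin n) → toℕ w <ᵇ s)
    ≡⟨ count≡sum (λ (w : Fin n) → toℕ w <ᵇ s) ⟩
      sum {n} (λ w → ⟦ toℕ w <ᵇ s ⟧)
    ≡⟨ sum-toℕ n (λ i → ⟦ i <ᵇ s ⟧) ⟩
      size (initial s)
    ≡⟨ size-initial s≤n ⟩
      s ∎
    where open ≡-Reasoning

  inCirc-Hs : ∀ u → inCirc (Hs n k s) u ≡ (toℕ u <ᵇ s)
  inCirc-Hs u with toℕ u <? s
  ... | no  u≮s rewrite ≥⇒<ᵇ≡false (≮⇒≥ u≮s) = refl
  ... | yes u<s rewrite <⇒<ᵇ≡true u<s =
    <⇒<ᵇ≡true (subst (2 <_) (sym (trans (count-cong (conn (Hs n k s) u) _ (λ w → conn-Hs u w u<s)) ∣Hs∣≡s)) 3≤s)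

  vCirc-Hs : vCirc (Hs n k s) ≡ s
  vCirc-Hs = trans (count-cong (inCirc (Hs n k s)) _ inCirc-Hs) ∣Hs∣≡s

  cCirc-Hs : cCirc (Hs n k s) ≡ 1
  cCirc-Hs = count-single IsRoot fzero root-0 only-root
    where
    root-0 : IsRoot fzero ≡ true
    root-0 = ∧-intro (trans (inCirc-Hs fzero) (<⇒<ᵇ≡true (≤-trans (s≤s z≤n) 3≤s)))
                     (allF-intro _ (λ w → ∨-introʳ (not (conn (Hs n k s) fzero w)) (≤⇒≤ᵇ≡true {0} {toℕ w} z≤n)))
    only-root : ∀ ρ → IsRoot ρ ≡ true → ρ ≡ fzero
    only-root ρ root = toℕ-injective (n≤0⇒n≡0 (root-least ρ fzero root (conn-sym fzero ρ (conn-from-0 ρ ρ<s))))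
      where
      ρ<s : toℕ ρ < s
      ρ<s = <ᵇ≡true⇒< _ _ (trans (sym (inCirc-Hs ρ)) (∧-elimˡ (inCirc (Hs n k s) ρ) root))

  initialEdges≤eCirc-Hs : initialEdges s ≤ eCirc (Hs n k s)
  initialEdges≤eCirc-Hs = begin
      edgesIn (initial s)
    ≡⟨ edgesIn-cong lift-initial ⟩
      edgesIn (lift V-Hs)
    ≡⟨ sym (edgesWithin≡edgesIn-lift V-Hs) ⟩
      edgesWithin n k V-Hs
    ≤⟨ edgesWithin≤eCirc (Hs n k s) V-Hs (λ u p → trans (inCirc-Hs u) p)
                         (λ u v _ v<s u<v → Hs-edge u v u<v (<ᵇ≡true⇒< _ _ v<s)) ⟩
      eCirc (Hs n k s) ∎
    where
    open ≤-Reasoning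
    V-Hs : Fin n → Bool
    V-Hs u = toℕ u <ᵇ s
    lift-initial : ∀ v → v < n → initial s v ≡ lift V-Hs v
    lift-initial v v<n with v <? n
    ... | yes p = cong (_<ᵇ s) (sym (toℕ-fromℕ< p))
    ... | no  v≮n = ⊥-elim (v≮n v<n)

  1≤initialEdges : 1 ≤ initialEdges s
  1≤initialEdges = begin
      1
    ≡⟨ cong ⟦_⟧ (sym (adj-near 0 1 z<s 1≤k (<-≤-trans (s≤s z<s) (≤-trans 3≤s s≤n)))) ⟩
      ⟦ adj 0 1 ⟧
    ≤⟨ ≤-trans (≤-reflexive (sym (+-identityʳ ⟦ adj 0 1 ⟧))) (term≤sumBelow n (λ u → ⟦ u <ᵇ 1 ⟧ * ⟦ adj u 1 ⟧) z<s) ⟩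
      backDegree 1
    ≤⟨ term≤sumBelow s backDegree (≤-trans (s≤s z<s) 3≤s) ⟩
      sumBelow s backDegree
    ≡⟨ sym (initialEdges≡sum-backDegree s≤n) ⟩
      initialEdges s ∎
    where open ≤-Reasoning

mkℚᵘ-mono : ∀ a b c d → a * suc d ≤ c * suc b → mkℚᵘ (ℤ.+ a) b ≤ℚ mkℚᵘ (ℤ.+ c) d
mkℚᵘ-mono a b c d ad≤cb = *≤* (subst₂ ℤ._≤_ (pos-* a (suc d)) (pos-* c (suc b)) (ℤ.+≤+ ad≤cb))

module MainTheorem (N k : ℕ) (3≤k : 3 ≤ k) (large : k * (k * k) + (k + k) ≤ N) where
  private
    k+k<n : k + k < suc N
    k+k<n = s≤s (≤-trans (m≤n+m (k + k) (k * (k * k))) large)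
    k³<n : k * (k * k) < suc N
    k³<n = s≤s (≤-trans (m≤m+n _ (k + k)) large)
    1≤k : 1 ≤ k
    1≤k = ≤-trans (s≤s z≤n) 3≤k

  open Circulant N k k+k<n

  γ≤γ-Hs : (F : SubGraph n k) → 0 < eCirc F → γ F ≤ℚ γ (Hs n k ∣ F ∣ᵥ)
  γ≤γ-Hs F e>0 with ∣ F ∣ᵥ <? 3
  ... | yes ∣F∣<3 = ⊥-elim (<-irrefl (sym (DensityBound.small⇒eCirc≡0 N k k+k<n k³<n 3≤k F ∣F∣<3)) e>0)
  ... | no  ∣F∣≮3 = mkℚᵘ-mono (eCirc F) _ (eCirc (Hs n k s)) _ (begin
      eCirc F * suc (vCirc (Hs n k s) ∸ 2 * cCirc (Hs n k s) ∸ 1)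
    ≡⟨ cong (λ x → eCirc F * suc (x ∸ 1)) denominator-Hs ⟩
      eCirc F * suc (s ∸ 2 ∸ 1)
    ≡⟨ cong (eCirc F *_) (sym (+-∸-assoc 1 (∸-monoˡ-≤ 2 3≤s))) ⟩
      eCirc F * (s ∸ 2)
    ≤⟨ DensityBound.eCirc-density-bound N k k+k<n k³<n 3≤k F ⟩
      initialEdges s * (vCirc F ∸ 2 * cCirc F)
    ≤⟨ *-mono-≤ (InitialSegment.initialEdges≤eCirc-Hs N k k+k<n 1≤k s 3≤s s≤n) (m≤n+m∸n (vCirc F ∸ 2 * cCirc F) 1) ⟩
      eCirc (Hs n k s) * suc (vCirc F ∸ 2 * cCirc F ∸ 1) ∎)
    where
    open ≤-Reasoning
    s : ℕ
    s = ∣ F ∣ᵥ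
    3≤s : 3 ≤ s
    3≤s = ≮⇒≥ ∣F∣≮3
    s≤n : s ≤ n
    s≤n = count≤ (V F)
    denominator-Hs : vCirc (Hs n k s) ∸ 2 * cCirc (Hs n k s) ≡ s ∸ 2
    denominator-Hs = cong₂ (λ v c → v ∸ 2 * c) (InitialSegment.vCirc-Hs N k k+k<n 1≤k s 3≤s s≤n)
                                               (InitialSegment.cCirc-Hs N k k+k<n 1≤k s 3≤s s≤n)

  Hs-attains-γ : (s : ℕ) → 3 ≤ s → s ≤ n → IsGammaOf n k s (γ (Hs n k s))
  Hs-attains-γ s 3≤s s≤n =
    (Hs n k s , ∣Hs∣≡s , ≤-trans 1≤initialEdges initialEdges≤eCirc-Hs , *≡* refl) ,
    (λ F ∣F∣≡s e>0 → subst (λ m → γ F ≤ℚ γ (Hs n k m)) ∣F∣≡s (γ≤γ-Hs F e>0))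
    where open InitialSegment N k k+k<n 1≤k s 3≤s s≤n

corollary3p4 : (k : ℕ) → 4 ≤ k →
    Σ ℕ (λ n₀ → (n : ℕ) → n₀ ≤ n →
      ((F : SubGraph n k) → 0 < eCirc F → γ F ≤ℚ γ (Hs n k ∣ F ∣ᵥ))
      × ((s : ℕ) → 3 ≤ s → s ≤ n → IsGammaOf n k s (γ (Hs n k s))))
corollary3p4 k 4≤k = suc (k * (k * k) + (k + k)) , λ { (suc N) (s≤s large) →
  MainTheorem.γ≤γ-Hs N k 3≤k large , MainTheorem.Hs-attains-γ N k 3≤k large }
  where
  3≤k : 3 ≤ k
  3≤k = ≤-trans (n≤1+n 3) 4≤k
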